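{- Let $q$ be a prime, $D\ge1$, $0\le i\le D$, $S\in\mathrm{Sym}_D$, and let $\mathcal{C},\mathcal{C}'\in GL(D,q)$ satisfy $\mathcal{C}^tS\mathcal{C}\in\mathrm{Sym}_{D,i}$ and $\mathcal{C}'^tS\mathcal{C}'\in\mathrm{Sym}_{D,i}$. Then $\rho((\mathcal{C},0))|[I],\mathcal{C}^tS\mathcal{C}\rangle_i=\rho((\mathcal{C}',0))|[I],\mathcal{C}'^tS\mathcal{C}'\rangle_i$ if and only if $\rho((\mathcal{C}^{ -1}\mathcal{C}',0))|x_i\rangle=|x_i\rangle$.
   Context: Equip $\mathbb{F}_q^{2D}$ with the non-degenerate symplectic form $\mathfrak{B}$ for which $e_1,\dots,e_D,f_1,\dots,f_D$ is a symplectic basis: $\mathfrak{B}(e_i,e_j)=\mathfrak{B}(f_i,f_j)=0$, $\mathfrak{B}(e_i,f_j)=-\mathfrak{B}(f_j,e_i)=\delta_{ij}$. Let $X$ be the set of maximal isotropic subspaces of $\mathbb{F}_q^{2D}$ and $V=\mathrm{span}_{\mathbb{C}}\{|x\rangle:x\in X\}$ with $\{|x\rangle\}$ orthonormal. Put $x_i=\mathrm{span}\{e_1,\dots,e_{D-i}\}\oplus\mathrm{span}\{f_{D-i+1},\dots,f_D\}$. $\mathrm{Sym}_D$ is the set of symmetric $D\times D$ matrices over $\mathbb{F}_q$, and $\mathrm{Sym}_{D,i}$ the subset of those $\mathcal{F}$ with $\mathcal{F}_{mn}=0$ whenever $m\le D-i$ or $n\le D-i$. For $\mathcal{C}\in GL(D,q)$,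 $\mathcal{F}\in\mathrm{Sym}_D$, $(\mathcal{C},\mathcal{F})\in Sp(2D,q)$ has matrix $\begin{pmatrix}\mathcal{C}&0\\0&(\mathcal{C}^t)^{ -1}\end{pmatrix}\begin{pmatrix}I&\mathcal{F}\\0&I\end{pmatrix}$ in the basis $(e_1,\dots,e_D,f_1,\dots,f_D)$. Elements $g\in Sp(2D,q)$ act on $X$ by $gx=\{gv:v\in x\}$ and $\rho(g)|x\rangle=|gx\rangle$. For $S'\in\mathrm{Sym}_{D,i}$, $|[I],S'\rangle_i=q^{ -i(i+1)/4}\sum_{\mathcal{F}\in\mathrm{Sym}_{D,i}}e^{2\pi\sqrt{ -1}\,\mathrm{tr}(S'\mathcal{F})/q}\,|(I,\mathcal{F})x_i\rangle$, where $\mathrm{tr}(S'\mathcal{F})\in\mathbb{F}_q$ is identified with an integer in $\{0,\dots,q-1\}$. -}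

module Defs where

open import Data.Nat using (ℕ; zero; suc; _+_; _*_; _∸_; _<_; _<ᵇ_; NonZero)
open import Data.Nat.DivMod using (_mod_)
open import Data.Fin as Fin using (Fin; toℕ)
open import Data.Integer as ℤ using (ℤ)
open import Data.Bool using (Bool; true; false; if_then_else_; _∧_; not; _xor_)
open import Data.List using (List; []; _∷_; map; foldr; concatMap; filterᵇ; allFin; [_])
open import Data.Bool.ListAction using (all; any)
open import Data.Product using (Σ; _×_; _,_)
open import Data.Sum using (_⊎_)
open import Relation.Nullary.Decidable using (⌊_⌋)
open import Relation.Binary.PropositionalEquality using (_≡_)

allFuns : {A : Set} → List A → (n : ℕ) → List (Fin n → A)
allFuns xs zero = (λ ()) ∷ []
allFuns xs (suc n) =
  concatMap (λ a → map (λ f → λ { Fin.zero → a ; (Fin.suc j) → f j }) (allFuns xs n)) xs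

module Field (q : ℕ) .{{nzq : NonZero q}} (D : ℕ) where

  Fq : Set
  Fq = Fin q

  0F 1F : Fq
  0F = 0 mod q
  1F = 1 mod q

  _+F_ _*F_ : Fq → Fq → Fq
  a +F b = (toℕ a + toℕ b) mod q
  a *F b = (toℕ a * toℕ b) mod q

  _==F_ : Fq → Fq → Bool
  a ==F b = ⌊ a Fin.≟ b ⌋

  allFq : List Fq
  allFq = allFin q

  ΣF : (n : ℕ) → (Fin n → Fq) → Fq
  ΣF zero f = 0F
  ΣF (suc n) f = f Fin.zero +F ΣF n (λ j → f (Fin.suc j))

  Mat : Set
  Mat = Fin D → Fin D → Fq

  _⊗_ : Mat → Mat → Mat
  (A ⊗ B) m n = ΣF D (λ k → A m k *F B k n)

  _ᵀ : Mat → Mat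
  (A ᵀ) m n = A n m

  Id : Mat
  Id m n = if ⌊ m Fin.≟ n ⌋ then 1F else 0F

  Zero : Mat
  Zero m n = 0F

  -- Ci is the inverse of C (so C ∈ GL(D,q))
  IsInverse : Mat → Mat → Set
  IsInverse C Ci = (∀ m n → (C ⊗ Ci) m n ≡ Id m n) × (∀ m n → (Ci ⊗ C) m n ≡ Id m n)

  IsSym : Mat → Set
  IsSym A = ∀ m n → A m n ≡ A n m

  -- Sym_{D,i}: symmetric, and F_mn = 0 whenever m ≤ D-i or n ≤ D-i (1-based),
  -- i.e. toℕ m < D ∸ i or toℕ n < D ∸ i (0-based).
  InSymDi : ℕ → Mat → Set
  InSymDi i A = IsSym A × (∀ m n → (toℕ m < D ∸ i ⊎ toℕ n < D ∸ i) → A m n ≡ 0F)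

  inSymDiᵇ : ℕ → Mat → Bool
  inSymDiᵇ i A = all (λ m → all (λ n →
      (A m n ==F A n m) ∧ (if (toℕ m <ᵇ D ∸ i) then (A m n ==F 0F)
                           else if (toℕ n <ᵇ D ∸ i) then (A m n ==F 0F) else true))
      (allFin D)) (allFin D)

  allMats : List Mat
  allMats = allFuns (allFuns allFq D) D

  symDi : ℕ → List Mat
  symDi i = filterᵇ (inSymDiᵇ i) allMats

  trF : Mat → Mat → Fq
  trF A B = ΣF D (λ m → ΣF D (λ n → A m n *F B n m))

  -- Vectors of F_q^{2D}: (a , b) stands for Σ a_j e_j + Σ b_j f_j.
  Vec2 : Set
  Vec2 = (Fin D → Fq) × (Fin D → Fq)

  allVec : List (Fin D → Fq)
  allVec = allFuns allFq D

  allVec2 : List Vec2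
  allVec2 = concatMap (λ a → map (λ b → a , b) allVec) allVec

  eqVᵇ : (Fin D → Fq) → (Fin D → Fq) → Bool
  eqVᵇ a b = all (λ j → a j ==F b j) (allFin D)

  eqV2ᵇ : Vec2 → Vec2 → Bool
  eqV2ᵇ (a , b) (a' , b') = eqVᵇ a a' ∧ eqVᵇ b b'

  _·v_ : Mat → (Fin D → Fq) → (Fin D → Fq)
  (A ·v a) m = ΣF D (λ k → A m k *F a k)

  _+v_ : (Fin D → Fq) → (Fin D → Fq) → (Fin D → Fq)
  (a +v b) m = a m +F b m

  -- A linear map of F_q^{2D} given by its block matrix ((A , B) , (C , Dm))
  -- in the basis (e_1..e_D, f_1..f_D).
  BlockMat : Set
  BlockMat = (Mat × Mat) × (Mat × Mat)

  apply : BlockMat → Vec2 → Vec2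
  apply ((A , B) , (C , Dm)) (a , b) = ((A ·v a) +v (B ·v b)) , ((C ·v a) +v (Dm ·v b))

  -- (C , 0) = diag(C , (Cᵗ)⁻¹), where Ci = C⁻¹ so (Cᵗ)⁻¹ = Ciᵗ.
  elemC : (C Ci : Mat) → BlockMat
  elemC C Ci = (C , Zero) , (Zero , (Ci ᵀ))

  elemF : Mat → BlockMat
  elemF F = (Id , F) , (Zero , Id)

  Sub : Set
  Sub = Vec2 → Bool

  eqSubᵇ : Sub → Sub → Bool
  eqSubᵇ x y = all (λ v → not (x v xor y v)) allVec2

  image : BlockMat → Sub → Sub
  image g x v = any (λ w → x w ∧ eqV2ᵇ (apply g w) v) allVec2

  -- x_i = span{e_1..e_{D-i}} ⊕ span{f_{D-i+1}..f_D}
  xsub : ℕ → Sub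
  xsub i (a , b) = all (λ j → if (toℕ j <ᵇ D ∸ i) then (b j ==F 0F) else (a j ==F 0F)) (allFin D)

  -- Z[ζ_q] ⊂ ℂ, ζ = e^{2π√-1/q}: Σ_k c_k ζ^k, presented as Z[x]/(1+x+…+x^{q-1}),
  -- i.e. coefficient vectors modulo constant vectors.
  Zζ : Set
  Zζ = Fq → ℤ

  0Z : Zζ
  0Z k = ℤ.+ 0

  _+Z_ : Zζ → Zζ → Zζ
  (a +Z b) k = a k ℤ.+ b k

  ζ^ : Fq → Zζ
  ζ^ j k = if (j ==F k) then ℤ.+ 1 else ℤ.+ 0

  _≈Z_ : Zζ → Zζ → Set
  a ≈Z b = Σ ℤ (λ c → ∀ k → a k ≡ b k ℤ.+ c)

  -- Elements of V: finite formal sums Σ c |x⟩.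
  VecV : Set
  VecV = List (Zζ × Sub)

  coeff : VecV → Sub → Zζ
  coeff s x = foldr (λ { (c , y) acc → if eqSubᵇ y x then c +Z acc else acc }) 0Z s

  -- equality in V: all coefficients ⟨x|·⟩ agree (|x⟩ orthonormal)
  _≈V_ : VecV → VecV → Set
  s ≈V t = ∀ (x : Sub) → coeff s x ≈Z coeff t x

  ket : Sub → VecV
  ket x = [ (ζ^ 0F , x) ]

  ρ : BlockMat → VecV → VecV
  ρ g s = map (λ { (c , y) → (c , image g y) }) s

  -- |[I], S'⟩_i  without the common normalisation q^{-i(i+1)/4}
  stateI : ℕ → Mat → VecV
  stateI i S' = map (λ F → (ζ^ (trF S' F) , image (elemF F) (xsub i))) (symDi i)

{-# OPTIONS --safe #-}

-- Put P = C⁻¹C'. Both sides are equivalent to P and P⁻¹ being block upper triangular for the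
-- splitting 𝔽_q^D = span{e_1..e_{D-i}} ⊕ span{e_{D-i+1}..e_D}, i.e. to (P,0) stabilising x_i.
-- For the kets this is immediate. For the states, the subspaces (C,0)(I,F)x_i with F ∈ Sym_{D,i}
-- are pairwise distinct, so each coefficient of ρ((C,0))|[I],CᵀSC⟩_i is either 0 or a single root
-- of unity, and roots of unity are nonzero in ℤ[ζ]. The coefficient at (C,0)x_i on the left is ζ^0,
-- so (C,0)x_i = (C',0)(I,F)x_i for some F, and this forces P (symmetrically P⁻¹) to be block upper
-- triangular. Conversely, for such P the map sending F to F' = P⁻¹FP⁻ᵀ with its first D-i rows
-- and columns cleared matches the terms of the two sums: (C,0)(I,F)x_i = (C',0)(I,F')x_i, and
-- tr(C'ᵀSC' F') = tr(CᵀSC F) because CᵀSC = P⁻ᵀ(C'ᵀSC')P⁻¹ and C'ᵀSC' vanishes on the cleared entries.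

module Submission where

open import Defs
open import Data.Nat using (ℕ; _≤_; NonZero)
open import Data.Nat.Primality using (Prime)
open import Function.Bundles using (_⇔_)

open import Algebra.Bundles using (CommutativeSemiring)
import Algebra.Properties.Semiring.Sum as SemiringSum
open import Algebra.Structures using (IsCommutativeSemiring; IsCommutativeMonoid)
open import Algebra.Structures.Biased using (isCommutativeSemiringˡ; isCommutativeMonoidˡ)
open import Data.Bool using (Bool; true; false; T; if_then_else_; _∧_; not; _xor_)
open import Data.Bool.ListAction using (all; any; and; or)
open import Data.Bool.Properties using (T-∧; T-≡)
open import Data.Empty using (⊥-elim)
open import Data.Fin using (Fin; zero; suc; toℕ)
open import Data.Fin.Properties using (_≟_)
import Data.Fin.Properties as Finₚ
open import Data.Integer as ℤ using (+_)
import Data.Integer.Properties as ℤₚ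
open import Data.List using (List; []; _∷_; _++_; map; concatMap; filterᵇ; allFin; tabulate)
open import Data.List.Membership.Propositional.Properties using (∈-allFin)
import Data.List.Properties as List
import Data.List.Relation.Unary.All as All
open import Data.List.Relation.Unary.All.Properties using (all⁺; all⁻)
open import Data.List.Relation.Unary.Any as Any using (Any; here; there; satisfied)
open import Data.List.Relation.Unary.Any.Properties using (any⁺; any⁻)
open import Data.Nat as ℕ using (zero; suc; _+_; _*_; _∸_; _<ᵇ_)
open import Data.Nat.DivMod using (_mod_; _%_; %-distribˡ-+; %-distribˡ-*; m<n⇒m%n≡m)
open import Data.Nat.Primality using (prime⇒nonTrivial)
open import Data.Nat.Properties using (0≢1+n; suc-injective)
import Data.Nat.Properties as ℕₚ
open import Data.Product using (∃; _×_; _,_; proj₁; proj₂)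
open import Data.Sum using (_⊎_; inj₁; inj₂)
open import Data.Vec.Functional using (Vector)
open import Function using (_∘_; const; id)
open import Function.Bundles using (Equivalence; mk⇔)
open Equivalence using (to; from)
import Function.Properties.Equivalence as ⇔
open import Level using (0ℓ)
open import Relation.Binary.Bundles using (Setoid)
open import Relation.Binary.PropositionalEquality
  using (_≡_; _≢_; refl; sym; trans; cong; cong₂; subst; _≗_; isEquivalence; module ≡-Reasoning)
import Relation.Binary.Reasoning.Setoid as SetoidReasoning
open import Relation.Nullary using (¬_; yes; no; Dec)
open import Relation.Nullary.Decidable using (⌊_⌋; toWitness; fromWitness)
open import Relation.Nullary.Reflects using (ofʸ; ofⁿ)

private variable A B C : Set

count : (A → Bool) → List A → ℕ
count p [] = 0
count p (x ∷ xs) = if p x then suc (count p xs) else count p xs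

count-++ : ∀ (p : A → Bool) xs ys → count p (xs ++ ys) ≡ count p xs + count p ys
count-++ p [] ys = refl
count-++ p (x ∷ xs) ys with p x
... | true = cong suc (count-++ p xs ys)
... | false = count-++ p xs ys

count-cong : {p p' : A → Bool} → (∀ x → p x ≡ p' x) → ∀ xs → count p xs ≡ count p' xs
count-cong e [] = refl
count-cong e (x ∷ xs) rewrite e x | count-cong e xs = refl

count-none : {p : A → Bool} → (∀ x → ¬ T (p x)) → ∀ xs → count p xs ≡ 0
count-none none [] = refl
count-none {p = p} none (x ∷ xs) with p x | none x
... | true | ¬px = ⊥-elim (¬px _)
... | false | _ = count-none none xs

count-zero-or-any : ∀ (p : A → Bool) xs → count p xs ≡ 0 ⊎ Any (T ∘ p) xs
count-zero-or-any p [] = inj₁ refl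
count-zero-or-any p (x ∷ xs) with p x in px
... | true = inj₂ (here (subst T (sym px) _))
... | false with count-zero-or-any p xs
...   | inj₁ c = inj₁ c
...   | inj₂ a = inj₂ (there a)

count-map : ∀ (p : A → Bool) (f : B → A) xs → count p (map f xs) ≡ count (p ∘ f) xs
count-map p f [] = refl
count-map p f (x ∷ xs) with p (f x)
... | true = cong suc (count-map p f xs)
... | false = count-map p f xs

count-product : ∀ (p : C → Bool) (q : A → Bool) (r : B → Bool) (c : A → B → C) →
                (∀ a b → p (c a b) ≡ q a ∧ r b) →
                ∀ xs ys → count p (concatMap (λ a → map (c a) ys) xs) ≡ count q xs * count r ys
count-product p q r c split [] ys = refl
count-product p q r c split (x ∷ xs) ys = begin
  count p (map (c x) ys ++ concatMap (λ a → map (c a) ys) xs)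
    ≡⟨ count-++ p (map (c x) ys) _ ⟩
  count p (map (c x) ys) + count p (concatMap (λ a → map (c a) ys) xs)
    ≡⟨ cong₂ _+_ (trans (count-map p (c x) ys) (count-cong (split x) ys))
                 (count-product p q r c split xs ys) ⟩
  count (λ b → q x ∧ r b) ys + count q xs * count r ys
    ≡⟨ row ⟩
  count q (x ∷ xs) * count r ys ∎
  where
  open ≡-Reasoning
  row : count (λ b → q x ∧ r b) ys + count q xs * count r ys ≡ count q (x ∷ xs) * count r ys
  row with q x
  ... | true = refl
  ... | false = cong (_+ count q xs * count r ys) (count-none (λ _ ()) ys)

Enumerates : (A → A → Bool) → List A → Set
Enumerates eq xs = ∀ b → count (λ a → eq a b) xs ≡ 1

count-suc⇒any : ∀ (p : A → Bool) xs {n} → count p xs ≡ suc n → Any (T ∘ p) xs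
count-suc⇒any p xs c with count-zero-or-any p xs
... | inj₁ c≡0 = ⊥-elim (0≢1+n (trans (sym c≡0) c))
... | inj₂ some = some

T-injective : ∀ {x y} → T x ⇔ T y → x ≡ y
T-injective {false} {false} _ = refl
T-injective {false} {true} e = ⊥-elim (from e _)
T-injective {true} {false} e = ⊥-elim (to e _)
T-injective {true} {true} _ = refl

T-not-xor : ∀ {x y} → T (not (x xor y)) ⇔ x ≡ y
T-not-xor {false} {false} = mk⇔ (λ _ → refl) _
T-not-xor {false} {true} = mk⇔ (λ ()) (λ ())
T-not-xor {true} {false} = mk⇔ (λ ()) (λ ())
T-not-xor {true} {true} = mk⇔ (λ _ → refl) _

T-all-allFin : ∀ {n} {p : Fin n → Bool} → T (all p (allFin n)) ⇔ (∀ j → T (p j))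
T-all-allFin {n} {p} = mk⇔ (λ t j → All.lookup (all⁺ p (allFin n) t) (∈-allFin j))
                            (λ h → all⁻ p {xs = allFin n} (All.tabulate (λ {j} _ → h j)))

⌊suc≟suc⌋ : ∀ {n} (a b : Fin n) → ⌊ suc a ≟ suc b ⌋ ≡ ⌊ a ≟ b ⌋
⌊suc≟suc⌋ a b with a ≟ b
... | yes _ = refl
... | no _ = refl

allFin-enumerates : ∀ n → Enumerates (λ a b → ⌊ a ≟ b ⌋) (allFin n)
allFin-enumerates (suc n) b =
  trans (cong (λ as → count (λ a → ⌊ a ≟ b ⌋) (zero ∷ as)) (sym (List.map-tabulate id suc)))
        (head-or-tail b)
  where
  head-or-tail : ∀ b → count (λ a → ⌊ a ≟ b ⌋) (zero ∷ map suc (allFin n)) ≡ 1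
  head-or-tail zero = cong suc (trans (count-map _ suc (allFin n)) (count-none (λ _ ()) (allFin n)))
  head-or-tail (suc b) = trans (count-map _ suc (allFin n))
                               (trans (count-cong (λ a → ⌊suc≟suc⌋ a b) (allFin n)) (allFin-enumerates n b))

pointwiseᵇ : (A → A → Bool) → ∀ {n} → (Fin n → A) → (Fin n → A) → Bool
pointwiseᵇ eq {zero} f g = true
pointwiseᵇ eq {suc n} f g = eq (f zero) (g zero) ∧ pointwiseᵇ eq (f ∘ suc) (g ∘ suc)

allFuns-enumerates : ∀ {eq : A → A → Bool} {xs} → Enumerates eq xs →
                     ∀ n → Enumerates (pointwiseᵇ eq {n}) (allFuns xs n)
allFuns-enumerates e zero b = refl
allFuns-enumerates {eq = eq} {xs} e (suc n) b =
  trans (count-product _ (λ a → eq a (b zero)) (λ f → pointwiseᵇ eq f (b ∘ suc)) _ (λ _ _ → refl)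
                       xs (allFuns xs n))
        (cong₂ _*_ (e (b zero)) (allFuns-enumerates e n (b ∘ suc)))

pointwiseᵇ-sound : ∀ {eq : A → A → Bool} {n} {f g : Fin n → A} →
                   T (pointwiseᵇ eq f g) → ∀ j → T (eq (f j) (g j))
pointwiseᵇ-sound {n = suc n} t zero = proj₁ (to T-∧ t)
pointwiseᵇ-sound {n = suc n} t (suc j) = pointwiseᵇ-sound (proj₂ (to T-∧ t)) j

pointwiseᵇ-complete : ∀ {eq : A → A → Bool} {n} {f g : Fin n → A} →
                      (∀ j → T (eq (f j) (g j))) → T (pointwiseᵇ eq f g)
pointwiseᵇ-complete {n = zero} h = _
pointwiseᵇ-complete {n = suc n} h = from T-∧ (h zero , pointwiseᵇ-complete (h ∘ suc))

module Arithmetic (q : ℕ) .{{_ : NonZero q}} (D : ℕ) where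
  open Field q D

  -- The laws of 𝔽_q are pulled back from those of ℕ along the surjective homomorphism [_].
  [_] : ℕ → Fq
  [ n ] = n mod q

  toℕ-[] : ∀ n → toℕ [ n ] ≡ n % q
  toℕ-[] n = Finₚ.toℕ-fromℕ< _

  [toℕ] : ∀ a → [ toℕ a ] ≡ a
  [toℕ] a = Finₚ.toℕ-injective (trans (toℕ-[] (toℕ a)) (m<n⇒m%n≡m (Finₚ.toℕ<n a)))

  []-+ : ∀ m n → [ m ] +F [ n ] ≡ [ m + n ]
  []-+ m n = Finₚ.toℕ-injective (begin
    toℕ ([ m ] +F [ n ])                ≡⟨ toℕ-[] _ ⟩
    (toℕ [ m ] + toℕ [ n ]) % q         ≡⟨ cong₂ (λ x y → (x + y) % q) (toℕ-[] m) (toℕ-[] n) ⟩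
    (m % q + n % q) % q                 ≡⟨ %-distribˡ-+ m n q ⟨
    (m + n) % q                         ≡⟨ toℕ-[] _ ⟨
    toℕ [ m + n ]                       ∎)
    where open ≡-Reasoning

  []-* : ∀ m n → [ m ] *F [ n ] ≡ [ m * n ]
  []-* m n = Finₚ.toℕ-injective (begin
    toℕ ([ m ] *F [ n ])                ≡⟨ toℕ-[] _ ⟩
    (toℕ [ m ] * toℕ [ n ]) % q         ≡⟨ cong₂ (λ x y → (x * y) % q) (toℕ-[] m) (toℕ-[] n) ⟩
    (m % q * (n % q)) % q               ≡⟨ %-distribˡ-* m n q ⟨
    (m * n) % q                         ≡⟨ toℕ-[] _ ⟨
    toℕ [ m * n ]                       ∎)
    where open ≡-Reasoning

  []-+ˡ : ∀ m a → [ m ] +F a ≡ [ m + toℕ a ]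
  []-+ˡ m a = trans (cong ([ m ] +F_) (sym ([toℕ] a))) ([]-+ m (toℕ a))

  []-+ʳ : ∀ a n → a +F [ n ] ≡ [ toℕ a + n ]
  []-+ʳ a n = trans (cong (_+F [ n ]) (sym ([toℕ] a))) ([]-+ (toℕ a) n)

  []-*ˡ : ∀ m a → [ m ] *F a ≡ [ m * toℕ a ]
  []-*ˡ m a = trans (cong ([ m ] *F_) (sym ([toℕ] a))) ([]-* m (toℕ a))

  []-*ʳ : ∀ a n → a *F [ n ] ≡ [ toℕ a * n ]
  []-*ʳ a n = trans (cong (_*F [ n ]) (sym ([toℕ] a))) ([]-* (toℕ a) n)

  +F-assoc : ∀ a b c → (a +F b) +F c ≡ a +F (b +F c)
  +F-assoc a b c =
    trans ([]-+ˡ _ c) (trans (cong [_] (ℕₚ.+-assoc (toℕ a) (toℕ b) (toℕ c))) (sym ([]-+ʳ a _)))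

  *F-assoc : ∀ a b c → (a *F b) *F c ≡ a *F (b *F c)
  *F-assoc a b c =
    trans ([]-*ˡ _ c) (trans (cong [_] (ℕₚ.*-assoc (toℕ a) (toℕ b) (toℕ c))) (sym ([]-*ʳ a _)))

  +F-comm : ∀ a b → a +F b ≡ b +F a
  +F-comm a b = cong [_] (ℕₚ.+-comm (toℕ a) (toℕ b))

  *F-comm : ∀ a b → a *F b ≡ b *F a
  *F-comm a b = cong [_] (ℕₚ.*-comm (toℕ a) (toℕ b))

  +F-identityˡ : ∀ a → 0F +F a ≡ a
  +F-identityˡ a = trans ([]-+ˡ 0 a) ([toℕ] a)

  *F-identityˡ : ∀ a → 1F *F a ≡ a
  *F-identityˡ a = trans ([]-*ˡ 1 a) (trans (cong [_] (ℕₚ.*-identityˡ (toℕ a))) ([toℕ] a))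

  *F-zeroˡ : ∀ a → 0F *F a ≡ 0F
  *F-zeroˡ a = []-*ˡ 0 a

  *F-distribʳ-+F : ∀ a b c → (b +F c) *F a ≡ (b *F a) +F (c *F a)
  *F-distribʳ-+F a b c =
    trans ([]-*ˡ _ a) (trans (cong [_] (ℕₚ.*-distribʳ-+ (toℕ a) (toℕ b) (toℕ c))) (sym ([]-+ _ _)))

  Fq-isCommutativeSemiring : IsCommutativeSemiring _≡_ _+F_ _*F_ 0F 1F
  Fq-isCommutativeSemiring = isCommutativeSemiringˡ record
    { +-isCommutativeMonoid = commutativeMonoid _+F_ 0F +F-assoc +F-identityˡ +F-comm
    ; *-isCommutativeMonoid = commutativeMonoid _*F_ 1F *F-assoc *F-identityˡ *F-comm
    ; distribʳ = *F-distribʳ-+F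
    ; zeroˡ = *F-zeroˡ
    }
    where
    commutativeMonoid : ∀ _∙_ ε → (∀ a b c → (a ∙ b) ∙ c ≡ a ∙ (b ∙ c)) →
                        (∀ a → ε ∙ a ≡ a) → (∀ a b → a ∙ b ≡ b ∙ a) → IsCommutativeMonoid _≡_ _∙_ ε
    commutativeMonoid _∙_ ε assoc identityˡ comm = isCommutativeMonoidˡ record
      { isSemigroup = record
        { isMagma = record { isEquivalence = isEquivalence ; ∙-cong = cong₂ _∙_ }
        ; assoc = assoc
        }
      ; identityˡ = identityˡ
      ; comm = comm
      }

  Fq-commutativeSemiring : CommutativeSemiring 0ℓ 0ℓ
  Fq-commutativeSemiring = record { isCommutativeSemiring = Fq-isCommutativeSemiring }

  open CommutativeSemiring Fq-commutativeSemiring public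
    using () renaming (+-identityʳ to +F-identityʳ; *-identityʳ to *F-identityʳ; zeroʳ to *F-zeroʳ)
  open SemiringSum (CommutativeSemiring.semiring Fq-commutativeSemiring)
    using (sum; sum-cong-≗; sum-replicate-zero; *-distribˡ-sum; *-distribʳ-sum; ∑-comm)

  ΣF≡sum : ∀ n (f : Vector Fq n) → ΣF n f ≡ sum f
  ΣF≡sum zero f = refl
  ΣF≡sum (suc n) f = cong (f zero +F_) (ΣF≡sum n (f ∘ suc))

  ΣF-cong : ∀ {n} {f g : Vector Fq n} → f ≗ g → ΣF n f ≡ ΣF n g
  ΣF-cong {n} {f} {g} f≗g = trans (ΣF≡sum n f) (trans (sum-cong-≗ f≗g) (sym (ΣF≡sum n g)))

  ΣF-zero : ∀ {n} {f : Vector Fq n} → f ≗ const 0F → ΣF n f ≡ 0F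
  ΣF-zero {n} f≗0 = trans (ΣF-cong f≗0) (trans (ΣF≡sum n _) (sum-replicate-zero n))

  *F-distribˡ-ΣF : ∀ {n} a (f : Vector Fq n) → a *F ΣF n f ≡ ΣF n (λ j → a *F f j)
  *F-distribˡ-ΣF {n} a f =
    trans (cong (a *F_) (ΣF≡sum n f)) (trans (*-distribˡ-sum a f) (sym (ΣF≡sum n _)))

  *F-distribʳ-ΣF : ∀ {n} a (f : Vector Fq n) → ΣF n f *F a ≡ ΣF n (λ j → f j *F a)
  *F-distribʳ-ΣF {n} a f =
    trans (cong (_*F a) (ΣF≡sum n f)) (trans (*-distribʳ-sum a f) (sym (ΣF≡sum n _)))

  ΣF-comm : ∀ m n (f : Fin m → Fin n → Fq) →
            ΣF m (λ j → ΣF n (f j)) ≡ ΣF n (λ k → ΣF m (λ j → f j k))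
  ΣF-comm m n f = begin
    ΣF m (λ j → ΣF n (f j))
      ≡⟨ trans (ΣF-cong (λ j → ΣF≡sum n (f j))) (ΣF≡sum m _) ⟩
    sum (λ j → sum (f j))
      ≡⟨ ∑-comm f ⟩
    sum (λ k → sum (λ j → f j k))
      ≡⟨ trans (ΣF-cong (λ k → ΣF≡sum m (λ j → f j k))) (ΣF≡sum n _) ⟨
    ΣF n (λ k → ΣF m (λ j → f j k)) ∎
    where open ≡-Reasoning

  ΣF-*-assoc : ∀ {m n} (x : Vector Fq m) (y : Fin m → Fin n → Fq) (z : Vector Fq n) →
               ΣF n (λ k → ΣF m (λ l → x l *F y l k) *F z k) ≡
               ΣF m (λ l → x l *F ΣF n (λ k → y l k *F z k))
  ΣF-*-assoc {m} {n} x y z = begin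
    ΣF n (λ k → ΣF m (λ l → x l *F y l k) *F z k)
      ≡⟨ ΣF-cong (λ k → *F-distribʳ-ΣF (z k) (λ l → x l *F y l k)) ⟩
    ΣF n (λ k → ΣF m (λ l → (x l *F y l k) *F z k))
      ≡⟨ ΣF-comm n m _ ⟩
    ΣF m (λ l → ΣF n (λ k → (x l *F y l k) *F z k))
      ≡⟨ ΣF-cong (λ l → ΣF-cong (λ k → *F-assoc (x l) (y l k) (z k))) ⟩
    ΣF m (λ l → ΣF n (λ k → x l *F (y l k *F z k)))
      ≡⟨ ΣF-cong (λ l → *F-distribˡ-ΣF (x l) (λ k → y l k *F z k)) ⟨
    ΣF m (λ l → x l *F ΣF n (λ k → y l k *F z k))
      ∎
    where open ≡-Reasoning

  δ : ∀ {n} → Fin n → Fin n → Fq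
  δ k j = if ⌊ k ≟ j ⌋ then 1F else 0F

  δ-sym : ∀ {n} (k j : Fin n) → δ k j ≡ δ j k
  δ-sym k j with k ≟ j | j ≟ k
  ... | yes _ | yes _ = refl
  ... | no _  | no _  = refl
  ... | yes k≡j | no j≢k = ⊥-elim (j≢k (sym k≡j))
  ... | no k≢j | yes j≡k = ⊥-elim (k≢j (sym j≡k))

  ΣF-δʳ : ∀ {n} (f : Vector Fq n) j → ΣF n (λ k → f k *F δ k j) ≡ f j
  ΣF-δʳ f zero =
    trans (cong₂ _+F_ (*F-identityʳ (f zero)) (ΣF-zero (λ k → *F-zeroʳ (f (suc k))))) (+F-identityʳ _)
  ΣF-δʳ f (suc j) =
    trans (cong₂ _+F_ (*F-zeroʳ (f zero)) (ΣF-cong δ-suc)) (trans (+F-identityˡ _) (ΣF-δʳ (f ∘ suc) j))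
    where
    δ-suc : ∀ k → f (suc k) *F δ (suc k) (suc j) ≡ f (suc k) *F δ k j
    δ-suc k = cong (λ b → f (suc k) *F (if b then 1F else 0F)) (⌊suc≟suc⌋ k j)

  δ-≢ : ∀ {n} {k j : Fin n} → k ≢ j → δ k j ≡ 0F
  δ-≢ {k = k} {j} k≢j with k ≟ j
  ... | yes k≡j = ⊥-elim (k≢j k≡j)
  ... | no _ = refl

  *F-congˡ-zero : ∀ {a} → a ≡ 0F → ∀ b c → a *F b ≡ a *F c
  *F-congˡ-zero a≡0 b c =
    trans (cong (_*F b) a≡0) (trans (*F-zeroˡ b) (sym (trans (cong (_*F c) a≡0) (*F-zeroˡ c))))

  *F-congʳ-zero : ∀ {b} → b ≡ 0F → ∀ a c → a *F b ≡ c *F b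
  *F-congʳ-zero b≡0 a c = trans (*F-comm a _) (trans (*F-congˡ-zero b≡0 a c) (*F-comm _ c))

  ΣF-δˡ : ∀ {n} (f : Vector Fq n) j → ΣF n (λ k → δ j k *F f k) ≡ f j
  ΣF-δˡ f j = trans (ΣF-cong (λ k → trans (*F-comm (δ j k) (f k)) (cong (f k *F_) (δ-sym j k)))) (ΣF-δʳ f j)

module Matrices (q : ℕ) .{{_ : NonZero q}} (D : ℕ) where
  open Field q D
  open Arithmetic q D

  infix 4 _≐_
  _≐_ : Mat → Mat → Set
  A ≐ B = ∀ m n → A m n ≡ B m n

  ≐-setoid : Setoid 0ℓ 0ℓ
  ≐-setoid = record
    { Carrier = Mat
    ; _≈_ = _≐_
    ; isEquivalence = record
      { refl = λ _ _ → refl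
      ; sym = λ e m n → sym (e m n)
      ; trans = λ e f m n → trans (e m n) (f m n)
      }
    }

  module ≐-Reasoning = SetoidReasoning ≐-setoid
  open Setoid ≐-setoid public using () renaming (refl to ≐-refl; sym to ≐-sym; trans to ≐-trans)

  ⊗-cong : ∀ {A A' B B'} → A ≐ A' → B ≐ B' → A ⊗ B ≐ A' ⊗ B'
  ⊗-cong A≐A' B≐B' m n = ΣF-cong (λ k → cong₂ _*F_ (A≐A' m k) (B≐B' k n))

  ⊗-congˡ : ∀ A {B B'} → B ≐ B' → A ⊗ B ≐ A ⊗ B'
  ⊗-congˡ A = ⊗-cong (≐-refl {A})

  ⊗-congʳ : ∀ {A A'} B → A ≐ A' → A ⊗ B ≐ A' ⊗ B
  ⊗-congʳ B A≐A' = ⊗-cong A≐A' (≐-refl {B})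

  ᵀ-cong : ∀ {A A'} → A ≐ A' → A ᵀ ≐ A' ᵀ
  ᵀ-cong A≐A' m n = A≐A' n m

  ⊗-assoc : ∀ A B C → (A ⊗ B) ⊗ C ≐ A ⊗ (B ⊗ C)
  ⊗-assoc A B C m n = ΣF-*-assoc (A m) B (λ k → C k n)

  ⊗-identityˡ : ∀ A → Id ⊗ A ≐ A
  ⊗-identityˡ A m n = ΣF-δˡ (λ k → A k n) m

  ⊗-identityʳ : ∀ A → A ⊗ Id ≐ A
  ⊗-identityʳ A m n = ΣF-δʳ (A m) n

  ᵀ-⊗ : ∀ A B → (A ⊗ B) ᵀ ≐ (B ᵀ) ⊗ (A ᵀ)
  ᵀ-⊗ A B m n = ΣF-cong (λ k → *F-comm (A n k) (B k m))

  Idᵀ : Id ᵀ ≐ Id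
  Idᵀ m n = δ-sym n m

  ·v-cong : ∀ {A A' a a'} → A ≐ A' → a ≗ a' → A ·v a ≗ A' ·v a'
  ·v-cong A≐A' a≗a' j = ΣF-cong (λ k → cong₂ _*F_ (A≐A' j k) (a≗a' k))

  ·v-congˡ : ∀ A {a a'} → a ≗ a' → A ·v a ≗ A ·v a'
  ·v-congˡ A = ·v-cong (≐-refl {A})

  ·v-congʳ : ∀ {A A'} → A ≐ A' → ∀ a → A ·v a ≗ A' ·v a
  ·v-congʳ A≐A' a = ·v-cong A≐A' (λ _ → refl)

  ·v-assoc : ∀ A B a → A ·v (B ·v a) ≗ (A ⊗ B) ·v a
  ·v-assoc A B a j = sym (ΣF-*-assoc (A j) B a)

  Id·v : ∀ a → Id ·v a ≗ a
  Id·v a = ΣF-δˡ a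

  Zero·v : ∀ a → Zero ·v a ≗ const 0F
  Zero·v a j = ΣF-zero (λ k → *F-zeroˡ (a k))

  ·v-zero : ∀ A → A ·v const 0F ≗ const 0F
  ·v-zero A j = ΣF-zero (λ k → *F-zeroʳ (A j k))

  unit : Fin D → Vector Fq D
  unit k j = δ j k

  ·v-unit : ∀ A k m → (A ·v unit k) m ≡ A m k
  ·v-unit A k m = ΣF-δʳ (A m) k

  trF-cong : ∀ {A A' B B'} → A ≐ A' → B ≐ B' → trF A B ≡ trF A' B'
  trF-cong A≐A' B≐B' = ΣF-cong (λ m → ΣF-cong (λ n → cong₂ _*F_ (A≐A' m n) (B≐B' n m)))

  trF-comm : ∀ A B → trF A B ≡ trF B A
  trF-comm A B =
    trans (ΣF-comm D D (λ m n → A m n *F B n m)) (ΣF-cong (λ n → ΣF-cong (λ m → *F-comm (A m n) (B n m))))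

  trF-assoc : ∀ A B C → trF A (B ⊗ C) ≡ trF (A ⊗ B) C
  trF-assoc A B C = ΣF-cong (λ m → sym (ΣF-*-assoc (A m) B (λ n → C n m)))

  ·v-inverse : ∀ {A B} → A ⊗ B ≐ Id → ∀ a → A ·v (B ·v a) ≗ a
  ·v-inverse {A} {B} AB≐Id a j = trans (·v-assoc A B a j) (trans (·v-congʳ AB≐Id a j) (Id·v a j))

  ·v-inverseᵀ : ∀ {A B} → A ⊗ B ≐ Id → ∀ b → (B ᵀ) ·v ((A ᵀ) ·v b) ≗ b
  ·v-inverseᵀ {A} {B} AB≐Id =
    ·v-inverse {B ᵀ} {A ᵀ} (≐-trans (≐-sym (ᵀ-⊗ A B)) (≐-trans (ᵀ-cong AB≐Id) Idᵀ))

  cancelˡ : ∀ {A B} → A ⊗ B ≐ Id → ∀ X → A ⊗ (B ⊗ X) ≐ X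
  cancelˡ {A} {B} AB≐Id X =
    ≐-trans (≐-sym (⊗-assoc A B X)) (≐-trans (⊗-congʳ X AB≐Id) (⊗-identityˡ X))

  cancelʳ : ∀ {A B} → A ⊗ B ≐ Id → ∀ X → (X ⊗ A) ⊗ B ≐ X
  cancelʳ {A} {B} AB≐Id X = ≐-trans (⊗-assoc X A B) (≐-trans (⊗-congˡ X AB≐Id) (⊗-identityʳ X))

  inverse-sym : ∀ {A A'} → IsInverse A A' → IsInverse A' A
  inverse-sym (AA'≐Id , A'A≐Id) = A'A≐Id , AA'≐Id

  inverse-⊗ : ∀ {A A' B B'} → IsInverse A A' → IsInverse B B' → IsInverse (A ⊗ B) (B' ⊗ A')
  inverse-⊗ {A} {A'} {B} {B'} (AA'≐Id , A'A≐Id) (BB'≐Id , B'B≐Id) =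
    ≐-trans (⊗-assoc A B (B' ⊗ A')) (≐-trans (⊗-congˡ A (cancelˡ {B} {B'} BB'≐Id A')) AA'≐Id) ,
    ≐-trans (⊗-assoc B' A' (A ⊗ B)) (≐-trans (⊗-congˡ B' (cancelˡ {A'} {A} A'A≐Id B)) B'B≐Id)

  congruence : Mat → Mat → Mat
  congruence C S = (C ᵀ) ⊗ (S ⊗ C)

  congruence-cong : ∀ {C C' S S'} → C ≐ C' → S ≐ S' → congruence C S ≐ congruence C' S'
  congruence-cong C≐C' S≐S' = ⊗-cong (ᵀ-cong C≐C') (⊗-cong S≐S' C≐C')

  congruence-⊗ : ∀ X C S → congruence X (congruence C S) ≐ congruence (C ⊗ X) S
  congruence-⊗ X C S = begin
    (X ᵀ) ⊗ (((C ᵀ) ⊗ (S ⊗ C)) ⊗ X)   ≈⟨ ⊗-congˡ (X ᵀ) (⊗-assoc (C ᵀ) (S ⊗ C) X) ⟩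
    (X ᵀ) ⊗ ((C ᵀ) ⊗ ((S ⊗ C) ⊗ X))   ≈⟨ ⊗-assoc (X ᵀ) (C ᵀ) _ ⟨
    ((X ᵀ) ⊗ (C ᵀ)) ⊗ ((S ⊗ C) ⊗ X)   ≈⟨ ⊗-cong (ᵀ-⊗ C X) (≐-sym (⊗-assoc S C X)) ⟨
    ((C ⊗ X) ᵀ) ⊗ (S ⊗ (C ⊗ X))       ∎
    where open ≐-Reasoning

  congruence-sym : ∀ C {S} → IsSym S → IsSym (congruence C S)
  congruence-sym C {S} S-sym m n = transpose n m
    where
    open ≐-Reasoning
    transpose : congruence C S ᵀ ≐ congruence C S
    transpose = begin
      ((C ᵀ) ⊗ (S ⊗ C)) ᵀ        ≈⟨ ᵀ-⊗ (C ᵀ) (S ⊗ C) ⟩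
      ((S ⊗ C) ᵀ) ⊗ C            ≈⟨ ⊗-congʳ C (ᵀ-⊗ S C) ⟩
      ((C ᵀ) ⊗ (S ᵀ)) ⊗ C        ≈⟨ ⊗-congʳ C (⊗-congˡ (C ᵀ) (λ m n → S-sym n m)) ⟩
      ((C ᵀ) ⊗ S) ⊗ C            ≈⟨ ⊗-assoc (C ᵀ) S C ⟩
      (C ᵀ) ⊗ (S ⊗ C)            ∎

  trF-congruence : ∀ A X F → trF A (congruence X F) ≡ trF (congruence (X ᵀ) A) F
  trF-congruence A X F = begin
    trF A ((X ᵀ) ⊗ (F ⊗ X))     ≡⟨ trF-assoc A (X ᵀ) (F ⊗ X) ⟩
    trF (A ⊗ (X ᵀ)) (F ⊗ X)     ≡⟨ trF-comm (A ⊗ (X ᵀ)) (F ⊗ X) ⟩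
    trF (F ⊗ X) (A ⊗ (X ᵀ))     ≡⟨ trF-assoc F X _ ⟨
    trF F (X ⊗ (A ⊗ (X ᵀ)))     ≡⟨ trF-comm F _ ⟩
    trF (X ⊗ (A ⊗ (X ᵀ))) F     ∎
    where open ≡-Reasoning

module Geometry (q : ℕ) .{{_ : NonZero q}} (D : ℕ) where
  open Field q D
  open Arithmetic q D
  open Matrices q D

  infix 4 _≈₂_ _∈_

  _≈₂_ : Vec2 → Vec2 → Set
  u ≈₂ w = proj₁ u ≗ proj₁ w × proj₂ u ≗ proj₂ w

  ≈₂-refl : ∀ {u} → u ≈₂ u
  ≈₂-refl = (λ _ → refl) , (λ _ → refl)

  ≈₂-sym : ∀ {u w} → u ≈₂ w → w ≈₂ u
  ≈₂-sym (e₁ , e₂) = sym ∘ e₁ , sym ∘ e₂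

  ≈₂-trans : ∀ {u v w} → u ≈₂ v → v ≈₂ w → u ≈₂ w
  ≈₂-trans (e₁ , e₂) (f₁ , f₂) = (λ j → trans (e₁ j) (f₁ j)) , (λ j → trans (e₂ j) (f₂ j))

  _∈_ : Vec2 → Sub → Set
  v ∈ y = T (y v)

  Extensional : Sub → Set
  Extensional y = ∀ {u w} → u ≈₂ w → y u ≡ y w

  T-eqVᵇ : ∀ {a b} → T (eqVᵇ a b) ⇔ a ≗ b
  T-eqVᵇ = mk⇔ (λ t j → toWitness (to T-all-allFin t j))
               (λ a≗b → from T-all-allFin (λ j → fromWitness (a≗b j)))

  T-eqV2ᵇ : ∀ {u w} → T (eqV2ᵇ u w) ⇔ u ≈₂ w
  T-eqV2ᵇ = mk⇔ (λ t → let t₁ , t₂ = to T-∧ t in to T-eqVᵇ t₁ , to T-eqVᵇ t₂)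
                (λ (e₁ , e₂) → from T-∧ (from T-eqVᵇ e₁ , from T-eqVᵇ e₂))

  eqV2ᵇ-cong : ∀ {u u' w w'} → u ≈₂ u' → w ≈₂ w' → eqV2ᵇ u w ≡ eqV2ᵇ u' w'
  eqV2ᵇ-cong (e₁ , e₂) (f₁ , f₂) = cong₂ _∧_ (eqVᵇ-cong e₁ f₁) (eqVᵇ-cong e₂ f₂)
    where
    eqVᵇ-cong : ∀ {a a' b b'} → a ≗ a' → b ≗ b' → eqVᵇ a b ≡ eqVᵇ a' b'
    eqVᵇ-cong a≗a' b≗b' = cong and (List.map-cong (λ j → cong₂ _==F_ (a≗a' j) (b≗b' j)) (allFin D))

  allVec-enumerates : Enumerates (pointwiseᵇ _==F_) allVec
  allVec-enumerates = allFuns-enumerates (allFin-enumerates q) D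

  allMats-enumerates : Enumerates (pointwiseᵇ (pointwiseᵇ _==F_)) allMats
  allMats-enumerates = allFuns-enumerates allVec-enumerates D

  T-pointwiseᵇ² : ∀ {A B} → T (pointwiseᵇ (pointwiseᵇ _==F_) A B) ⇔ A ≐ B
  T-pointwiseᵇ² =
    mk⇔ (λ t m n → toWitness (pointwiseᵇ-sound (pointwiseᵇ-sound t m) n))
        (λ A≐B → pointwiseᵇ-complete (λ m → pointwiseᵇ-complete (λ n → fromWitness (A≐B m n))))

  allVec2-complete : ∀ v → Any (_≈₂ v) allVec2
  allVec2-complete (a , b) =
    Any.map (λ t → let ta , tb = to T-∧ t in ≗-from ta , ≗-from tb)
            (count-suc⇒any matches allVec2
              (trans (count-product matches (λ a' → pointwiseᵇ _==F_ a' a) (λ b' → pointwiseᵇ _==F_ b' b)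
                                    _,_ (λ _ _ → refl) allVec allVec)
                     (cong₂ _*_ (allVec-enumerates a) (allVec-enumerates b))))
    where
    matches : Vec2 → Bool
    matches (a' , b') = pointwiseᵇ _==F_ a' a ∧ pointwiseᵇ _==F_ b' b
    ≗-from : ∀ {c c'} → T (pointwiseᵇ _==F_ c c') → c ≗ c'
    ≗-from t j = toWitness (pointwiseᵇ-sound t j)

  apply-cong : ∀ g {u w} → u ≈₂ w → apply g u ≈₂ apply g w
  apply-cong ((A , B) , (C , E)) (e₁ , e₂) =
    (λ j → cong₂ _+F_ (·v-congˡ A e₁ j) (·v-congˡ B e₂ j)) ,
    (λ j → cong₂ _+F_ (·v-congˡ C e₁ j) (·v-congˡ E e₂ j))

  image-extensional : ∀ g y → Extensional (image g y)
  image-extensional g y u≈w =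
    cong or (List.map-cong (λ w' → cong (y w' ∧_) (eqV2ᵇ-cong ≈₂-refl u≈w)) allVec2)

  image-cong : ∀ {g g'} y → (∀ w → apply g w ≈₂ apply g' w) → ∀ v → image g y v ≡ image g' y v
  image-cong y g≈g' v =
    cong or (List.map-cong (λ w → cong (y w ∧_) (eqV2ᵇ-cong (g≈g' w) ≈₂-refl)) allVec2)

  ∈-image⁻ : ∀ g y {v} → v ∈ image g y → ∃ λ w → w ∈ y × apply g w ≈₂ v
  ∈-image⁻ g y t with satisfied (any⁻ _ allVec2 t)
  ... | w , tw = let w∈y , gw≈v = to T-∧ tw in w , w∈y , to T-eqV2ᵇ gw≈v

  ∈-image⁺ : ∀ g {y} → Extensional y → ∀ {w v} → w ∈ y → apply g w ≈₂ v → v ∈ image g y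
  ∈-image⁺ g {y} y-ext {w} {v} w∈y gw≈v = any⁺ _ (Any.map member (allVec2-complete w))
    where
    member : ∀ {w'} → w' ≈₂ w → T (y w' ∧ eqV2ᵇ (apply g w') v)
    member w'≈w =
      from T-∧ (subst T (sym (y-ext w'≈w)) w∈y , from T-eqV2ᵇ (≈₂-trans (apply-cong g w'≈w) gw≈v))

  image-inverse : ∀ g h {y} → Extensional y →
                  (∀ v → apply g (apply h v) ≈₂ v) → (∀ w → apply h (apply g w) ≈₂ w) →
                  ∀ v → image g y v ≡ y (apply h v)
  image-inverse g h {y} y-ext gh≈id hg≈id v =
    T-injective (mk⇔ image⇒ (λ t → ∈-image⁺ g y-ext t (gh≈id v)))
    where
    image⇒ : v ∈ image g y → apply h v ∈ y
    image⇒ t with ∈-image⁻ g y t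
    ... | w , w∈y , gw≈v = subst T (y-ext (≈₂-trans (≈₂-sym (hg≈id w)) (apply-cong h gw≈v))) w∈y

  image-injective : ∀ g h {y y'} → Extensional y → Extensional y' →
                    (∀ v → apply g (apply h v) ≈₂ v) → (∀ w → apply h (apply g w) ≈₂ w) →
                    (∀ v → image g y v ≡ image g y' v) → ∀ v → y v ≡ y' v
  image-injective g h {y} {y'} y-ext y'-ext gh≈id hg≈id gy≡gy' v = begin
    y v                       ≡⟨ y-ext (hg≈id v) ⟨
    y (apply h (apply g v))   ≡⟨ image-inverse g h y-ext gh≈id hg≈id (apply g v) ⟨
    image g y (apply g v)     ≡⟨ gy≡gy' (apply g v) ⟩
    image g y' (apply g v)    ≡⟨ image-inverse g h y'-ext gh≈id hg≈id (apply g v) ⟩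
    y' (apply h (apply g v))  ≡⟨ y'-ext (hg≈id v) ⟩
    y' v                      ∎
    where open ≡-Reasoning

  apply-elemC : ∀ C Ci v → apply (elemC C Ci) v ≈₂ (C ·v proj₁ v , (Ci ᵀ) ·v proj₂ v)
  apply-elemC C Ci (a , b) =
    (λ j → trans (cong ((C ·v a) j +F_) (Zero·v b j)) (+F-identityʳ _)) ,
    (λ j → trans (cong (_+F ((Ci ᵀ) ·v b) j) (Zero·v a j)) (+F-identityˡ _))

  apply-elemF : ∀ F v → apply (elemF F) v ≈₂ ((λ j → proj₁ v j +F (F ·v proj₂ v) j) , proj₂ v)
  apply-elemF F (a , b) =
    (λ j → cong (_+F (F ·v b) j) (Id·v a j)) ,
    (λ j → trans (cong₂ _+F_ (Zero·v a j) (Id·v b j)) (+F-identityˡ _))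

  apply-elemC-inverse : ∀ C Ci → C ⊗ Ci ≐ Id → ∀ v → apply (elemC C Ci) (apply (elemC Ci C) v) ≈₂ v
  apply-elemC-inverse C Ci C⊗Ci≐Id v =
    ≈₂-trans (apply-elemC C Ci _)
      (≈₂-trans (·v-congˡ C (proj₁ (apply-elemC Ci C v)) ,
                 ·v-congˡ (Ci ᵀ) (proj₂ (apply-elemC Ci C v)))
                (·v-inverse {C} {Ci} C⊗Ci≐Id (proj₁ v) , ·v-inverseᵀ {C} {Ci} C⊗Ci≐Id (proj₂ v)))

  image-elemC : ∀ C Ci {y} → IsInverse C Ci → Extensional y →
                ∀ v → image (elemC C Ci) y v ≡ y (Ci ·v proj₁ v , (C ᵀ) ·v proj₂ v)
  image-elemC C Ci (C⊗Ci≐Id , Ci⊗C≐Id) y-ext v =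
    trans (image-inverse (elemC C Ci) (elemC Ci C) y-ext
                         (apply-elemC-inverse C Ci C⊗Ci≐Id) (apply-elemC-inverse Ci C Ci⊗C≐Id) v)
          (y-ext (apply-elemC Ci C v))

  image-elemC-injective : ∀ C Ci {y y'} → IsInverse C Ci → Extensional y → Extensional y' →
                          (∀ v → image (elemC C Ci) y v ≡ image (elemC C Ci) y' v) → ∀ v → y v ≡ y' v
  image-elemC-injective C Ci (C⊗Ci≐Id , Ci⊗C≐Id) y-ext y'-ext =
    image-injective (elemC C Ci) (elemC Ci C) y-ext y'-ext
                    (apply-elemC-inverse C Ci C⊗Ci≐Id) (apply-elemC-inverse Ci C Ci⊗C≐Id)

  eqSubᵇ-refl : ∀ y → T (eqSubᵇ y y)
  eqSubᵇ-refl y = all⁻ _ {xs = allVec2} (All.universal (λ v → from (T-not-xor {y v}) refl) allVec2)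

  eqSubᵇ-congˡ : ∀ {y y'} x → (∀ v → y v ≡ y' v) → eqSubᵇ y x ≡ eqSubᵇ y' x
  eqSubᵇ-congˡ x y≡y' = cong and (List.map-cong (λ v → cong (λ b → not (b xor x v)) (y≡y' v)) allVec2)

  eqSubᵇ-common : ∀ {y y' x} → T (eqSubᵇ y x) → T (eqSubᵇ y' x) → T (eqSubᵇ y y')
  eqSubᵇ-common {y} {y'} {x} t t' = all⁻ _ {xs = allVec2} (All.zipWith agree (y≡x , y'≡x))
    where
    y≡x = all⁺ (λ v → not (y v xor x v)) allVec2 t
    y'≡x = all⁺ (λ v → not (y' v xor x v)) allVec2 t'
    agree : ∀ {v} → T (not (y v xor x v)) × T (not (y' v xor x v)) → T (not (y v xor y' v))
    agree {v} (e , e') =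
      from (T-not-xor {y v}) (trans (to (T-not-xor {y v}) e) (sym (to (T-not-xor {y' v}) e')))

  eqSubᵇ⇒≡ : ∀ {y y'} → Extensional y → Extensional y' → T (eqSubᵇ y y') → ∀ v → y v ≡ y' v
  eqSubᵇ⇒≡ {y} {y'} y-ext y'-ext t v
    with All.lookupAny (all⁺ (λ w → not (y w xor y' w)) allVec2 t) (allVec2-complete v)
  ... | e , w≈v = trans (sym (y-ext w≈v)) (trans (to (T-not-xor {y _}) e) (y'-ext w≈v))

module Subspaces (q : ℕ) .{{_ : NonZero q}} (D i : ℕ) where
  open Field q D
  open Arithmetic q D
  open Matrices q D
  open Geometry q D

  -- Indices are 0-based: Low j says that e_j is one of the first D - i basis vectors.
  Low : Fin D → Set
  Low j = toℕ j ℕ.< D ∸ i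

  low? : ∀ j → Dec (Low j)
  low? j = toℕ j ℕ.<? D ∸ i

  if-low : ∀ {A : Set} {x y : A} j → Low j → (if toℕ j <ᵇ D ∸ i then x else y) ≡ x
  if-low j l with toℕ j <ᵇ D ∸ i | ℕₚ.<ᵇ-reflects-< (toℕ j) (D ∸ i)
  ... | true | _ = refl
  ... | false | ofⁿ ¬l = ⊥-elim (¬l l)

  if-high : ∀ {A : Set} {x y : A} j → ¬ Low j → (if toℕ j <ᵇ D ∸ i then x else y) ≡ y
  if-high j h with toℕ j <ᵇ D ∸ i | ℕₚ.<ᵇ-reflects-< (toℕ j) (D ∸ i)
  ... | true | ofʸ l = ⊥-elim (h l)
  ... | false | _ = refl

  low≢high : ∀ {j k} → Low j → ¬ Low k → j ≢ k
  low≢high l h refl = h l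

  VanishesLow : Vector Fq D → Set
  VanishesLow b = ∀ j → Low j → b j ≡ 0F

  infix 4 _≈ʰ_
  _≈ʰ_ : Vector Fq D → Vector Fq D → Set
  a ≈ʰ a' = ∀ j → ¬ Low j → a j ≡ a' j

  unit-vanishesLow : ∀ {k} → ¬ Low k → VanishesLow (unit k)
  unit-vanishesLow h j l = δ-≢ (low≢high l h)

  unit-vanishesHigh : ∀ {k} → Low k → unit k ≈ʰ const 0F
  unit-vanishesHigh l j h = δ-≢ (low≢high l h ∘ sym)

  ∈xsub⁻ : ∀ {v} → v ∈ xsub i → VanishesLow (proj₂ v) × proj₁ v ≈ʰ const 0F
  ∈xsub⁻ t = (λ j l → toWitness (subst T (if-low j l) (holds j))) ,
             (λ j h → toWitness (subst T (if-high j h) (holds j)))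
    where holds = to T-all-allFin t

  ∈xsub⁺ : ∀ {a b} → VanishesLow b → a ≈ʰ const 0F → (a , b) ∈ xsub i
  ∈xsub⁺ {a} {b} b-low a-high = from T-all-allFin holds
    where
    holds : ∀ j → T (if toℕ j <ᵇ D ∸ i then b j ==F 0F else a j ==F 0F)
    holds j with low? j
    ... | yes l = subst T (sym (if-low j l)) (fromWitness (b-low j l))
    ... | no h = subst T (sym (if-high j h)) (fromWitness (a-high j h))

  xsub-extensional : Extensional (xsub i)
  xsub-extensional (e₁ , e₂) = cong and (List.map-cong condition (allFin D))
    where
    condition = λ j → cong₂ (λ a b → if toℕ j <ᵇ D ∸ i then b ==F 0F else a ==F 0F) (e₁ j) (e₂ j)

  Λ : Mat → Sub
  Λ F = image (elemF F) (xsub i)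

  Λ-extensional : ∀ F → Extensional (Λ F)
  Λ-extensional F = image-extensional (elemF F) (xsub i)

  Λ-cong : ∀ {F F'} → F ≐ F' → ∀ v → Λ F v ≡ Λ F' v
  Λ-cong {F} {F'} F≐F' = image-cong {elemF F} {elemF F'} (xsub i) λ w →
    ≈₂-trans (apply-elemF F w)
      (≈₂-trans ((λ j → cong (proj₁ w j +F_) (·v-congʳ F≐F' (proj₂ w) j)) , (λ _ → refl))
                (≈₂-sym (apply-elemF F' w)))

  ∈Λ⁻ : ∀ F {v} → v ∈ Λ F → VanishesLow (proj₂ v) × proj₁ v ≈ʰ F ·v proj₂ v
  ∈Λ⁻ F t with ∈-image⁻ (elemF F) (xsub i) t
  ... | w , w∈x , Fw≈v = b-low , a-high
    where
    e = ≈₂-trans (≈₂-sym (apply-elemF F w)) Fw≈v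
    b-low : VanishesLow _
    b-low j l = trans (sym (proj₂ e j)) (proj₁ (∈xsub⁻ w∈x) j l)
    a-high : _ ≈ʰ _
    a-high j h = begin
      _                               ≡⟨ proj₁ e j ⟨
      proj₁ w j +F (F ·v proj₂ w) j   ≡⟨ cong (_+F _) (proj₂ (∈xsub⁻ w∈x) j h) ⟩
      0F +F (F ·v proj₂ w) j          ≡⟨ +F-identityˡ _ ⟩
      (F ·v proj₂ w) j                ≡⟨ ·v-congˡ F (proj₂ e) j ⟩
      _                               ∎
      where open ≡-Reasoning

  ∈Λ⁺ : ∀ {F} → InSymDi i F → ∀ {a b} → VanishesLow b → a ≈ʰ F ·v b → (a , b) ∈ Λ F
  ∈Λ⁺ {F} (_ , F-zero) {a} {b} b-low a≈Fb =
    ∈-image⁺ (elemF F) xsub-extensional (∈xsub⁺ b-low (λ j h → if-high j h))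
             (≈₂-trans (apply-elemF F (lowPart , b)) (first , (λ _ → refl)))
    where
    lowPart : Vector Fq D
    lowPart j = if toℕ j <ᵇ D ∸ i then a j else 0F
    first : ∀ j → lowPart j +F (F ·v b) j ≡ a j
    first j with low? j
    ... | yes l = trans (cong₂ _+F_ (if-low j l) (ΣF-zero (λ k → trans (cong (_*F b k) (F-zero j k (inj₁ l)))
                                                                     (*F-zeroˡ _))))
                        (+F-identityʳ _)
    ... | no h = trans (cong (_+F _) (if-high j h)) (trans (+F-identityˡ _) (sym (a≈Fb j h)))

  Λ-injective : ∀ {F F'} → InSymDi i F → InSymDi i F' → (∀ v → Λ F v ≡ Λ F' v) → F ≐ F'
  Λ-injective {F} {F'} F-symᵢ@(_ , F-zero) (_ , F'-zero) ΛF≡ΛF' m n with low? m | low? n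
  ... | yes l | _ = trans (F-zero m n (inj₁ l)) (sym (F'-zero m n (inj₁ l)))
  ... | no _ | yes l = trans (F-zero m n (inj₂ l)) (sym (F'-zero m n (inj₂ l)))
  ... | no hm | no hn = begin
    F m n               ≡⟨ ·v-unit F n m ⟨
    (F ·v unit n) m     ≡⟨ proj₂ (∈Λ⁻ F' (subst T (ΛF≡ΛF' _) column∈ΛF)) m hm ⟩
    (F' ·v unit n) m    ≡⟨ ·v-unit F' n m ⟩
    F' m n              ∎
    where
    open ≡-Reasoning
    column∈ΛF : (F ·v unit n , unit n) ∈ Λ F
    column∈ΛF = ∈Λ⁺ F-symᵢ (unit-vanishesLow hn) (λ _ _ → refl)

  -- P maps span{e_k : Low k} into itself.
  BlockUpperTriangular : Mat → Set
  BlockUpperTriangular P = ∀ j k → ¬ Low j → Low k → P j k ≡ 0F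

  ᵀ·v-vanishesLow : ∀ {P b} → BlockUpperTriangular P → VanishesLow b → VanishesLow ((P ᵀ) ·v b)
  ᵀ·v-vanishesLow {P} {b} P-but b-low j l = ΣF-zero term
    where
    term : ∀ k → P k j *F b k ≡ 0F
    term k with low? k
    ... | yes lk = trans (cong (P k j *F_) (b-low k lk)) (*F-zeroʳ (P k j))
    ... | no hk = trans (cong (_*F b k) (P-but k j hk l)) (*F-zeroˡ _)

  ·v-≈ʰ : ∀ {P a a'} → BlockUpperTriangular P → a ≈ʰ a' → P ·v a ≈ʰ P ·v a'
  ·v-≈ʰ {P} {a} {a'} P-but a≈a' j h = ΣF-cong term
    where
    term : ∀ k → P j k *F a k ≡ P j k *F a' k
    term k with low? k
    ... | yes lk = *F-congˡ-zero (P-but j k h lk) (a k) (a' k)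
    ... | no hk = cong (P j k *F_) (a≈a' k hk)

  elemC-stabilises-xsub : ∀ {P Pi} → IsInverse P Pi →
    (∀ v → image (elemC P Pi) (xsub i) v ≡ xsub i v) ⇔ (BlockUpperTriangular P × BlockUpperTriangular Pi)
  elemC-stabilises-xsub {P} {Pi} inv@(P⊗Pi≐Id , _) = mk⇔ stable⇒triangular triangular⇒stable
    where
    stable⇒triangular : (∀ v → image (elemC P Pi) (xsub i) v ≡ xsub i v) →
                        BlockUpperTriangular P × BlockUpperTriangular Pi
    stable⇒triangular stable = P-but , Pi-but
      where
      moved : ∀ {w} → w ∈ xsub i → (P ·v proj₁ w , (Pi ᵀ) ·v proj₂ w) ∈ xsub i
      moved {w} w∈x = subst T (xsub-extensional (apply-elemC P Pi w))
                        (subst T (stable _) (∈-image⁺ (elemC P Pi) xsub-extensional w∈x ≈₂-refl))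
      P-but : BlockUpperTriangular P
      P-but j k hj lk = trans (sym (·v-unit P k j))
        (proj₂ (∈xsub⁻ (moved (∈xsub⁺ {unit k} {const 0F} (λ _ _ → refl) (unit-vanishesHigh lk)))) j hj)
      Pi-but : BlockUpperTriangular Pi
      Pi-but j k hj lk = trans (sym (·v-unit (Pi ᵀ) j k))
        (proj₁ (∈xsub⁻ (moved (∈xsub⁺ {const 0F} {unit j} (unit-vanishesLow hj) (λ _ _ → refl)))) k lk)
    triangular⇒stable : BlockUpperTriangular P × BlockUpperTriangular Pi →
                        ∀ v → image (elemC P Pi) (xsub i) v ≡ xsub i v
    triangular⇒stable (P-but , Pi-but) v@(a , b) =
      trans (image-elemC P Pi inv xsub-extensional v) (T-injective (mk⇔ back forth))
      where
      forth : (a , b) ∈ xsub i → (Pi ·v a , (P ᵀ) ·v b) ∈ xsub i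
      forth t = ∈xsub⁺ (ᵀ·v-vanishesLow P-but (proj₁ (∈xsub⁻ t)))
                       (λ j h → trans (·v-≈ʰ Pi-but (proj₂ (∈xsub⁻ t)) j h) (·v-zero Pi j))
      back : (Pi ·v a , (P ᵀ) ·v b) ∈ xsub i → (a , b) ∈ xsub i
      back t = ∈xsub⁺ (λ j l → trans (sym (·v-inverseᵀ {P} {Pi} P⊗Pi≐Id b j))
                                     (ᵀ·v-vanishesLow Pi-but (proj₁ (∈xsub⁻ t)) j l))
                      (λ j h → trans (sym (·v-inverse {P} {Pi} P⊗Pi≐Id a j))
                                     (trans (·v-≈ʰ P-but (proj₂ (∈xsub⁻ t)) j h) (·v-zero P j)))

  truncate : Mat → Mat
  truncate M m n = if toℕ m <ᵇ D ∸ i then 0F else if toℕ n <ᵇ D ∸ i then 0F else M m n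

  truncate-high : ∀ M {m n} → ¬ Low m → ¬ Low n → truncate M m n ≡ M m n
  truncate-high M {m} {n} hm hn = trans (if-high m hm) (if-high n hn)

  truncate-low : ∀ M {m n} → Low m ⊎ Low n → truncate M m n ≡ 0F
  truncate-low M {m} (inj₁ lm) = if-low m lm
  truncate-low M {m} {n} (inj₂ ln) with low? m
  ... | yes lm = if-low m lm
  ... | no hm = trans (if-high m hm) (if-low n ln)

  truncate-InSymDi : ∀ {M} → IsSym M → InSymDi i (truncate M)
  truncate-InSymDi {M} M-sym = symmetric , (λ m n → truncate-low M)
    where
    symmetric : IsSym (truncate M)
    symmetric m n with low? m | low? n
    ... | yes lm | _ = trans (truncate-low M (inj₁ lm)) (sym (truncate-low M (inj₂ lm)))
    ... | no _ | yes ln = trans (truncate-low M (inj₂ ln)) (sym (truncate-low M (inj₁ ln)))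
    ... | no hm | no hn = trans (truncate-high M hm hn) (trans (M-sym m n) (sym (truncate-high M hn hm)))

  truncate-·v : ∀ M {b} → VanishesLow b → truncate M ·v b ≈ʰ M ·v b
  truncate-·v M {b} b-low m hm = ΣF-cong term
    where
    term : ∀ n → truncate M m n *F b n ≡ M m n *F b n
    term n with low? n
    ... | yes ln = *F-congʳ-zero (b-low n ln) (truncate M m n) (M m n)
    ... | no hn = cong (_*F b n) (truncate-high M hm hn)

  trF-truncate : ∀ {A} → InSymDi i A → ∀ M → trF A (truncate M) ≡ trF A M
  trF-truncate {A} (_ , A-zero) M = ΣF-cong (λ m → ΣF-cong (term m))
    where
    term : ∀ m n → A m n *F truncate M n m ≡ A m n *F M n m
    term m n with low? m | low? n
    ... | yes lm | _ = *F-congˡ-zero (A-zero m n (inj₁ lm)) (truncate M n m) (M n m)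
    ... | no _ | yes ln = *F-congˡ-zero (A-zero m n (inj₂ ln)) (truncate M n m) (M n m)
    ... | no hm | no hn = cong (A m n *F_) (truncate-high M hn hm)

  transport : Mat → Mat → Mat
  transport Pi F = truncate (congruence (Pi ᵀ) F)

  transport-InSymDi : ∀ Pi {F} → InSymDi i F → InSymDi i (transport Pi F)
  transport-InSymDi Pi (F-sym , _) = truncate-InSymDi (congruence-sym (Pi ᵀ) F-sym)

  Λ-congruence : ∀ {P Pi F} → BlockUpperTriangular P → BlockUpperTriangular Pi → P ⊗ Pi ≐ Id →
                 InSymDi i F → ∀ a b → Λ F (a , b) ≡ Λ (transport Pi F) (Pi ·v a , (P ᵀ) ·v b)
  Λ-congruence {P} {Pi} {F} P-but Pi-but P⊗Pi≐Id F-symᵢ a b = T-injective (mk⇔ forth back)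
    where
    W G : Mat
    W = congruence (Pi ᵀ) F
    G = truncate W
    W·Pᵀb : W ·v ((P ᵀ) ·v b) ≗ Pi ·v (F ·v b)
    W·Pᵀb j = begin
      (W ·v ((P ᵀ) ·v b)) j                      ≡⟨ ·v-assoc Pi (F ⊗ (Pi ᵀ)) _ j ⟨
      (Pi ·v ((F ⊗ (Pi ᵀ)) ·v ((P ᵀ) ·v b))) j
                                                 ≡⟨ ·v-congˡ Pi (λ k → sym (·v-assoc F (Pi ᵀ) _ k)) j ⟩
      (Pi ·v (F ·v ((Pi ᵀ) ·v ((P ᵀ) ·v b)))) j
                                                 ≡⟨ ·v-congˡ Pi (·v-congˡ F (·v-inverseᵀ {P} {Pi} P⊗Pi≐Id b)) j ⟩
      (Pi ·v (F ·v b)) j                         ∎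
      where open ≡-Reasoning
    forth : (a , b) ∈ Λ F → (Pi ·v a , (P ᵀ) ·v b) ∈ Λ G
    forth t = ∈Λ⁺ (transport-InSymDi Pi F-symᵢ) Pᵀb-low
                  (λ j h → trans (·v-≈ʰ Pi-but (proj₂ (∈Λ⁻ F t)) j h)
                                 (trans (sym (W·Pᵀb j)) (sym (truncate-·v W Pᵀb-low j h))))
      where Pᵀb-low = ᵀ·v-vanishesLow P-but (proj₁ (∈Λ⁻ F t))
    back : (Pi ·v a , (P ᵀ) ·v b) ∈ Λ G → (a , b) ∈ Λ F
    back t = ∈Λ⁺ F-symᵢ b-low a≈Fb
      where
      Pᵀb-low = proj₁ (∈Λ⁻ G t)
      b-low : VanishesLow b
      b-low j l = trans (sym (·v-inverseᵀ {P} {Pi} P⊗Pi≐Id b j)) (ᵀ·v-vanishesLow Pi-but Pᵀb-low j l)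
      Pia≈Pi·Fb : Pi ·v a ≈ʰ Pi ·v (F ·v b)
      Pia≈Pi·Fb k h = trans (proj₂ (∈Λ⁻ G t) k h) (trans (truncate-·v W Pᵀb-low k h) (W·Pᵀb k))
      a≈Fb : a ≈ʰ F ·v b
      a≈Fb j h = begin
        a j                        ≡⟨ ·v-inverse {P} {Pi} P⊗Pi≐Id a j ⟨
        (P ·v (Pi ·v a)) j         ≡⟨ ·v-≈ʰ P-but Pia≈Pi·Fb j h ⟩
        (P ·v (Pi ·v (F ·v b))) j  ≡⟨ ·v-inverse {P} {Pi} P⊗Pi≐Id (F ·v b) j ⟩
        (F ·v b) j                 ∎
        where open ≡-Reasoning

  Ω : Mat → Mat → Mat → Sub
  Ω C Ci F = image (elemC C Ci) (Λ F)

  Ω-extensional : ∀ C Ci F → Extensional (Ω C Ci F)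
  Ω-extensional C Ci F = image-extensional (elemC C Ci) (Λ F)

  Ω-cong : ∀ C Ci {F F'} → F ≐ F' → ∀ v → Ω C Ci F v ≡ Ω C Ci F' v
  Ω-cong C Ci F≐F' v =
    cong or (List.map-cong (λ w → cong (_∧ eqV2ᵇ (apply (elemC C Ci) w) v) (Λ-cong F≐F' w)) allVec2)

  Ω-injective : ∀ C Ci {F F'} → IsInverse C Ci → InSymDi i F → InSymDi i F' →
                (∀ v → Ω C Ci F v ≡ Ω C Ci F' v) → F ≐ F'
  Ω-injective C Ci {F} {F'} inv F-symᵢ F'-symᵢ ΩF≡ΩF' =
    Λ-injective F-symᵢ F'-symᵢ (image-elemC-injective C Ci inv (Λ-extensional F) (Λ-extensional F') ΩF≡ΩF')

  Ω-transfer : ∀ C Ci C' Ci' {F} → IsInverse C Ci → IsInverse C' Ci' →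
               BlockUpperTriangular (Ci ⊗ C') → BlockUpperTriangular (Ci' ⊗ C) → InSymDi i F →
               ∀ v → Ω C Ci F v ≡ Ω C' Ci' (transport (Ci' ⊗ C) F) v
  Ω-transfer C Ci C' Ci' {F} invC@(C⊗Ci≐Id , _) invC' P-but Pi-but F-symᵢ v@(a , b) = begin
    Ω C Ci F v                                        ≡⟨ image-elemC C Ci invC (Λ-extensional F) v ⟩
    Λ F (Ci ·v a , (C ᵀ) ·v b)                        ≡⟨ Λ-congruence P-but Pi-but P⊗Pi≐Id F-symᵢ _ _ ⟩
    Λ G (Pi ·v (Ci ·v a) , (P ᵀ) ·v ((C ᵀ) ·v b))    ≡⟨ Λ-extensional G (Pi·Ci·a , Pᵀ·Cᵀ·b) ⟩
    Λ G (Ci' ·v a , (C' ᵀ) ·v b)                      ≡⟨ image-elemC C' Ci' invC' (Λ-extensional G) v ⟨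
    Ω C' Ci' G v                                      ∎
    where
    open ≡-Reasoning
    P Pi G : Mat
    P = Ci ⊗ C'
    Pi = Ci' ⊗ C
    G = transport Pi F
    P⊗Pi≐Id : P ⊗ Pi ≐ Id
    P⊗Pi≐Id = proj₁ (inverse-⊗ {Ci} {C} {C'} {Ci'} (inverse-sym {C} {Ci} invC) invC')
    Pi·Ci·a : Pi ·v (Ci ·v a) ≗ Ci' ·v a
    Pi·Ci·a j = trans (·v-assoc Pi Ci a j) (·v-congʳ (cancelʳ {C} {Ci} C⊗Ci≐Id Ci') a j)
    Pᵀ·Cᵀ·b : (P ᵀ) ·v ((C ᵀ) ·v b) ≗ (C' ᵀ) ·v b
    Pᵀ·Cᵀ·b j = trans (·v-assoc (P ᵀ) (C ᵀ) b j)
                      (·v-congʳ (≐-trans (≐-sym (ᵀ-⊗ C P)) (ᵀ-cong (cancelˡ {C} {Ci} C⊗Ci≐Id C'))) b j)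

  trF-transfer : ∀ C C' Ci' S → C' ⊗ Ci' ≐ Id → InSymDi i (congruence C' S) →
                 ∀ F → trF (congruence C' S) (transport (Ci' ⊗ C) F) ≡ trF (congruence C S) F
  trF-transfer C C' Ci' S C'⊗Ci'≐Id S'-symᵢ F = begin
    trF (congruence C' S) (transport Pi F)          ≡⟨ trF-truncate S'-symᵢ _ ⟩
    trF (congruence C' S) (congruence (Pi ᵀ) F)     ≡⟨ trF-congruence (congruence C' S) (Pi ᵀ) F ⟩
    trF (congruence Pi (congruence C' S)) F         ≡⟨ trF-cong (congruence-⊗ Pi C' S) (≐-refl {F}) ⟩
    trF (congruence (C' ⊗ Pi) S) F
                                                    ≡⟨ trF-cong (congruence-cong C'⊗Pi≐C (≐-refl {S})) (≐-refl {F}) ⟩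
    trF (congruence C S) F                          ∎
    where
    open ≡-Reasoning
    Pi : Mat
    Pi = Ci' ⊗ C
    C'⊗Pi≐C : C' ⊗ Pi ≐ C
    C'⊗Pi≐C = cancelˡ {C'} {Ci'} C'⊗Ci'≐Id C

  InSymDi-cong : ∀ {A B} → A ≐ B → InSymDi i A → InSymDi i B
  InSymDi-cong A≐B (A-sym , A-zero) =
    (λ m n → trans (sym (A≐B m n)) (trans (A-sym m n) (A≐B n m))) ,
    (λ m n l → trans (sym (A≐B m n)) (A-zero m n l))

  T-inSymDiᵇ : ∀ {A} → T (inSymDiᵇ i A) ⇔ InSymDi i A
  T-inSymDiᵇ {A} = mk⇔ sound complete
    where
    zero-block : Fin D → Fin D → Bool
    zero-block m n = if toℕ m <ᵇ D ∸ i then A m n ==F 0F else if toℕ n <ᵇ D ∸ i then A m n ==F 0F else true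
    zero-block-low : ∀ {m n} → Low m ⊎ Low n → zero-block m n ≡ (A m n ==F 0F)
    zero-block-low {m} (inj₁ lm) = if-low m lm
    zero-block-low {m} {n} (inj₂ ln) with low? m
    ... | yes lm = if-low m lm
    ... | no hm = trans (if-high m hm) (if-low n ln)
    sound : T (inSymDiᵇ i A) → InSymDi i A
    sound t = (λ m n → toWitness (proj₁ (holds m n))) ,
              (λ m n l → toWitness (subst T (zero-block-low l) (proj₂ (holds m n))))
      where
      holds : ∀ m n → T (A m n ==F A n m) × T (zero-block m n)
      holds m n = to T-∧ (to T-all-allFin (to T-all-allFin t m) n)
    complete : InSymDi i A → T (inSymDiᵇ i A)
    complete (A-sym , A-zero) =
      from T-all-allFin λ m → from T-all-allFin λ n → from T-∧ (fromWitness (A-sym m n) , block m n)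
      where
      block : ∀ m n → T (zero-block m n)
      block m n with low? m | low? n
      ... | yes lm | _ = subst T (sym (zero-block-low (inj₁ lm))) (fromWitness (A-zero m n (inj₁ lm)))
      ... | no _ | yes ln = subst T (sym (zero-block-low (inj₂ ln))) (fromWitness (A-zero m n (inj₂ ln)))
      ... | no hm | no hn = subst T (sym (trans (if-high m hm) (if-high n hn))) _

module Coefficients (q : ℕ) .{{_ : NonZero q}} (D : ℕ) where
  open Field q D
  open Arithmetic q D
  open Geometry q D

  ≗⇒≈Z : ∀ {a b} → a ≗ b → a ≈Z b
  ≗⇒≈Z a≗b = + 0 , λ k → trans (a≗b k) (sym (ℤₚ.+-identityʳ _))

  ≈Z-sym : ∀ {a b} → a ≈Z b → b ≈Z a
  ≈Z-sym {a} {b} (c , a≡b+c) = ℤ.- c , λ k → sym (begin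
    a k ℤ.+ ℤ.- c             ≡⟨ cong (ℤ._+ ℤ.- c) (a≡b+c k) ⟩
    (b k ℤ.+ c) ℤ.+ ℤ.- c     ≡⟨ ℤₚ.+-assoc (b k) c (ℤ.- c) ⟩
    b k ℤ.+ (c ℤ.+ ℤ.- c)     ≡⟨ cong (ℤ._+_ (b k)) (ℤₚ.+-inverseʳ c) ⟩
    b k ℤ.+ + 0               ≡⟨ ℤₚ.+-identityʳ (b k) ⟩
    b k                       ∎)
    where open ≡-Reasoning

  ≈Z-respects-≗ : ∀ {a a' b b'} → a ≗ a' → b ≗ b' → a ≈Z b → a' ≈Z b'
  ≈Z-respects-≗ a≗a' b≗b' (c , a≡b+c) =
    c , λ k → trans (sym (a≗a' k)) (trans (a≡b+c k) (cong (ℤ._+ c) (b≗b' k)))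

  ≈V-sym : ∀ {s t} → s ≈V t → t ≈V s
  ≈V-sym s≈t x = ≈Z-sym (s≈t x)

  0F≢1F : 1 ℕ.< q → 0F ≢ 1F
  0F≢1F 1<q 0F≡1F = 0≢1+n (begin
    0          ≡⟨ m<n⇒m%n≡m (ℕₚ.<-trans ℕₚ.0<1+n 1<q) ⟨
    0 % q      ≡⟨ toℕ-[] 0 ⟨
    toℕ 0F     ≡⟨ cong toℕ 0F≡1F ⟩
    toℕ 1F     ≡⟨ toℕ-[] 1 ⟩
    1 % q      ≡⟨ m<n⇒m%n≡m 1<q ⟩
    1          ∎)
    where open ≡-Reasoning

  ζ^-diag : ∀ a → ζ^ a a ≡ + 1
  ζ^-diag a with a ≟ a
  ... | yes _ = refl
  ... | no a≢a = ⊥-elim (a≢a refl)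

  ζ^-off : ∀ {a b} → a ≢ b → ζ^ a b ≡ + 0
  ζ^-off {a} {b} a≢b with a ≟ b
  ... | yes a≡b = ⊥-elim (a≢b a≡b)
  ... | no _ = refl

  another : 1 ℕ.< q → ∀ a → ∃ λ b → a ≢ b
  another 1<q a with a ≟ 0F
  ... | yes a≡0 = 1F , λ a≡1 → 0F≢1F 1<q (trans (sym a≡0) a≡1)
  ... | no a≢0 = 0F , a≢0

  ζ^≉0Z : 1 ℕ.< q → ∀ a → ¬ (ζ^ a ≈Z 0Z)
  ζ^≉0Z 1<q a (c , ζ^a≡c) with another 1<q a
  ... | b , a≢b = +1≢+0 (begin
    + 1              ≡⟨ ζ^-diag a ⟨
    ζ^ a a           ≡⟨ ζ^a≡c a ⟩
    + 0 ℤ.+ c        ≡⟨ ζ^a≡c b ⟨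
    ζ^ a b           ≡⟨ ζ^-off a≢b ⟩
    + 0              ∎)
    where
    open ≡-Reasoning
    +1≢+0 : + 1 ≢ + 0
    +1≢+0 ()

  module _ {A : Set} (e : A → Zζ × Sub) (p : A → Bool) (x : Sub) where

    matching : A → Bool
    matching a = p a ∧ eqSubᵇ (proj₂ (e a)) x

    coeff-none : ∀ L → count matching L ≡ 0 → coeff (map e (filterᵇ p L)) x ≗ 0Z
    coeff-none [] _ k = refl
    coeff-none (a ∷ L) c k with p a
    ... | false = coeff-none L c k
    ... | true with eqSubᵇ (proj₂ (e a)) x
    ...   | false = coeff-none L c k
    coeff-none (a ∷ L) () k | true | true

    coeff-unique : ∀ {z} → (∀ a → T (matching a) → proj₁ (e a) ≗ z) →
                   ∀ L → count matching L ≡ 1 → coeff (map e (filterᵇ p L)) x ≗ z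
    coeff-unique {z} e≗z (a ∷ L) c k with p a in pa
    ... | false = coeff-unique e≗z L c k
    ... | true with eqSubᵇ (proj₂ (e a)) x in ea
    ...   | false = coeff-unique e≗z L c k
    ...   | true = trans (cong₂ ℤ._+_ (e≗z a (subst T (sym (cong₂ _∧_ pa ea)) _) k)
                                     (coeff-none L (suc-injective c) k))
                         (ℤₚ.+-identityʳ (z k))

  ρ-ket-fixed⇔ : 1 ℕ.< q → ∀ g {y} → Extensional y →
                 (ρ g (ket y) ≈V ket y) ⇔ (∀ v → image g y v ≡ y v)
  ρ-ket-fixed⇔ 1<q g {y} y-ext = mk⇔ fixed⇒ ⇒fixed
    where
    fixed⇒ : ρ g (ket y) ≈V ket y → ∀ v → image g y v ≡ y v
    fixed⇒ gy≈y = eqSubᵇ⇒≡ (image-extensional g y) y-ext agree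
      where
      agree : T (eqSubᵇ (image g y) y)
      agree with eqSubᵇ (image g y) y in gy-y
      ... | true = _
      ... | false = ⊥-elim (ζ^≉0Z 1<q 0F (≈Z-sym (≈Z-respects-≗ gy-coeff≗0 y-coeff≗ζ^0 (gy≈y y))))
        where
        gy-coeff≗0 : coeff (ρ g (ket y)) y ≗ 0Z
        gy-coeff≗0 k = cong (λ b → (if b then ζ^ 0F +Z 0Z else 0Z) k) gy-y
        y-coeff≗ζ^0 : coeff (ket y) y ≗ ζ^ 0F
        y-coeff≗ζ^0 k = trans (cong (λ b → (if b then ζ^ 0F +Z 0Z else 0Z) k) (to T-≡ (eqSubᵇ-refl y)))
                              (ℤₚ.+-identityʳ _)
    ⇒fixed : (∀ v → image g y v ≡ y v) → ρ g (ket y) ≈V ket y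
    ⇒fixed gy≡y x =
      ≗⇒≈Z (λ k → cong (λ b → (if b then ζ^ 0F +Z 0Z else 0Z) k) (eqSubᵇ-congˡ x gy≡y))

module Stabiliser (q : ℕ) .{{_ : NonZero q}} (D i : ℕ) (1<q : 1 ℕ.< q) where
  open Field q D
  open Arithmetic q D
  open Matrices q D
  open Geometry q D
  open Subspaces q D i
  open Coefficients q D

  state : Mat → Mat → Mat → VecV
  state C Ci S' = ρ (elemC C Ci) (stateI i S')

  matchesᵇ : Mat → Mat → Sub → Mat → Bool
  matchesᵇ C Ci x F = inSymDiᵇ i F ∧ eqSubᵇ (Ω C Ci F) x

  matches⁻ : ∀ C Ci x F → T (matchesᵇ C Ci x F) → InSymDi i F × T (eqSubᵇ (Ω C Ci F) x)
  matches⁻ C Ci x F t =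
    let F-symᵢ , F-matches = to (T-∧ {inSymDiᵇ i F}) t in to T-inSymDiᵇ F-symᵢ , F-matches

  module _ (C Ci F₀ : Mat) (x : Sub) (inv : IsInverse C Ci) (F₀-symᵢ : InSymDi i F₀)
           (F₀-matches : T (eqSubᵇ (Ω C Ci F₀) x)) where

    matches⇒≐ : ∀ F → T (matchesᵇ C Ci x F) → F ≐ F₀
    matches⇒≐ F t = Ω-injective C Ci inv F-symᵢ F₀-symᵢ
      (eqSubᵇ⇒≡ (Ω-extensional C Ci F) (Ω-extensional C Ci F₀)
                (eqSubᵇ-common {Ω C Ci F} F-matches F₀-matches))
      where
      F-symᵢ = proj₁ (matches⁻ C Ci x F t)
      F-matches = proj₂ (matches⁻ C Ci x F t)

    ≐⇒matches : ∀ F → F ≐ F₀ → T (matchesᵇ C Ci x F)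
    ≐⇒matches F F≐F₀ = from T-∧ (from T-inSymDiᵇ (InSymDi-cong (≐-sym F≐F₀) F₀-symᵢ) ,
                                 subst T (sym (eqSubᵇ-congˡ x (Ω-cong C Ci F≐F₀))) F₀-matches)

    matches-once : count (matchesᵇ C Ci x) allMats ≡ 1
    matches-once = trans (count-cong matches≡≐ allMats) (allMats-enumerates F₀)
      where
      matches≡≐ : ∀ F → matchesᵇ C Ci x F ≡ pointwiseᵇ (pointwiseᵇ _==F_) F F₀
      matches≡≐ F =
        T-injective (mk⇔ (from T-pointwiseᵇ² ∘ matches⇒≐ F) (≐⇒matches F ∘ to T-pointwiseᵇ²))

    coeff-state-match : ∀ S' → coeff (state C Ci S') x ≗ ζ^ (trF S' F₀)
    coeff-state-match S' k =
      trans (cong (λ s → coeff s x k) (sym (List.map-∘ (symDi i))))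
            (coeff-unique (λ F → ζ^ (trF S' F) , Ω C Ci F) (inSymDiᵇ i) x
                          (λ F t k → cong (λ a → ζ^ a k) (trF-cong (≐-refl {S'}) (matches⇒≐ F t)))
                          allMats matches-once k)

  coeff-state-none : ∀ C Ci x S' → count (matchesᵇ C Ci x) allMats ≡ 0 → coeff (state C Ci S') x ≗ 0Z
  coeff-state-none C Ci x S' none k =
    trans (cong (λ s → coeff s x k) (sym (List.map-∘ (symDi i))))
          (coeff-none (λ F → ζ^ (trF S' F) , Ω C Ci F) (inSymDiᵇ i) x allMats none k)

  Zero-InSymDi : InSymDi i Zero
  Zero-InSymDi = (λ _ _ → refl) , (λ _ _ _ → refl)

  shared-orbit⇒triangular : ∀ C Ci C' Ci' {F} → IsInverse C Ci → InSymDi i F →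
                            (∀ v → Ω C' Ci' F v ≡ Ω C Ci Zero v) → BlockUpperTriangular (Ci ⊗ C')
  shared-orbit⇒triangular C Ci C' Ci' {F} invC F-symᵢ ΩF≡ΩZero j k hj lk = begin
    (Ci ⊗ C') j k               ≡⟨ ·v-unit (Ci ⊗ C') k j ⟨
    ((Ci ⊗ C') ·v unit k) j     ≡⟨ ·v-assoc Ci C' (unit k) j ⟨
    (Ci ·v (C' ·v unit k)) j    ≡⟨ ·v-congˡ Ci (proj₁ (apply-elemC C' Ci' w)) j ⟨
    (Ci ·v proj₁ v) j           ≡⟨ proj₂ (∈Λ⁻ Zero v∈ΩZero) j hj ⟩
    (Zero ·v _) j               ≡⟨ Zero·v _ j ⟩
    0F                          ∎
    where
    open ≡-Reasoning
    w v : Vec2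
    w = unit k , const 0F
    v = apply (elemC C' Ci') w
    w∈ΛF : w ∈ Λ F
    w∈ΛF = ∈Λ⁺ F-symᵢ (λ _ _ → refl) (λ j' h → trans (unit-vanishesHigh lk j' h) (sym (·v-zero F j')))
    v∈ΩZero : (Ci ·v proj₁ v , (C ᵀ) ·v proj₂ v) ∈ Λ Zero
    v∈ΩZero = subst T (image-elemC C Ci invC (Λ-extensional Zero) v)
                (subst T (ΩF≡ΩZero v) (∈-image⁺ (elemC C' Ci') (Λ-extensional F) w∈ΛF ≈₂-refl))

  states⇒triangular : ∀ C Ci C' Ci' S₁ S₂ → IsInverse C Ci → IsInverse C' Ci' →
                      state C Ci S₁ ≈V state C' Ci' S₂ → BlockUpperTriangular (Ci ⊗ C')
  states⇒triangular C Ci C' Ci' S₁ S₂ invC invC' states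
    with count-zero-or-any (matchesᵇ C' Ci' (Ω C Ci Zero)) allMats
  ... | inj₁ none =
    ⊥-elim (ζ^≉0Z 1<q (trF S₁ Zero) (≈Z-respects-≗ lhs≗ζ^ rhs≗0 (states (Ω C Ci Zero))))
    where
    lhs≗ζ^ = coeff-state-match C Ci Zero (Ω C Ci Zero) invC Zero-InSymDi (eqSubᵇ-refl (Ω C Ci Zero)) S₁
    rhs≗0 = coeff-state-none C' Ci' (Ω C Ci Zero) S₂ none
  ... | inj₂ some with satisfied some
  ...   | F , t = shared-orbit⇒triangular C Ci C' Ci' invC (proj₁ F-matches)
                    (eqSubᵇ⇒≡ (Ω-extensional C' Ci' F) (Ω-extensional C Ci Zero) (proj₂ F-matches))
    where F-matches = matches⁻ C' Ci' (Ω C Ci Zero) F t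

  triangular⇒states : ∀ C Ci C' Ci' S → IsInverse C Ci → IsInverse C' Ci' →
                      BlockUpperTriangular (Ci ⊗ C') → BlockUpperTriangular (Ci' ⊗ C) →
                      InSymDi i (congruence C S) → InSymDi i (congruence C' S) →
                      state C Ci (congruence C S) ≈V state C' Ci' (congruence C' S)
  triangular⇒states C Ci C' Ci' S invC invC' P-but Pi-but S₁-symᵢ S₂-symᵢ x
    with count-zero-or-any (matchesᵇ C Ci x) allMats
  ... | inj₂ some with satisfied some
  ...   | F , t = ≗⇒≈Z λ k → begin
    coeff (state C Ci S₁) x k     ≡⟨ coeff-state-match C Ci F x invC F-symᵢ F-matches S₁ k ⟩
    ζ^ (trF S₁ F) k               ≡⟨ cong (λ a → ζ^ a k) (trF-transfer C C' Ci' S (proj₁ invC') S₂-symᵢ F) ⟨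
    ζ^ (trF S₂ G) k               ≡⟨ coeff-state-match C' Ci' G x invC' G-symᵢ G-matches S₂ k ⟨
    coeff (state C' Ci' S₂) x k   ∎
    where
    open ≡-Reasoning
    F-symᵢ = proj₁ (matches⁻ C Ci x F t)
    F-matches = proj₂ (matches⁻ C Ci x F t)
    G = transport (Ci' ⊗ C) F
    G-symᵢ = transport-InSymDi (Ci' ⊗ C) F-symᵢ
    G-matches : T (eqSubᵇ (Ω C' Ci' G) x)
    G-matches = subst T (eqSubᵇ-congˡ x (Ω-transfer C Ci C' Ci' invC invC' P-but Pi-but F-symᵢ)) F-matches
    S₁ S₂ : Mat
    S₁ = congruence C S
    S₂ = congruence C' S
  triangular⇒states C Ci C' Ci' S invC invC' P-but Pi-but S₁-symᵢ S₂-symᵢ x | inj₁ none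
    with count-zero-or-any (matchesᵇ C' Ci' x) allMats
  ... | inj₁ none' = ≗⇒≈Z (λ k → trans (coeff-state-none C Ci x (congruence C S) none k)
                                       (sym (coeff-state-none C' Ci' x (congruence C' S) none' k)))
  ... | inj₂ some' with satisfied some'
  -- A matching term on the right transfers back to a matching term on the left.
  ...   | F' , t' = ⊥-elim (0≢1+n (trans (sym none) (matches-once C Ci G' x invC G'-symᵢ G'-matches)))
    where
    F'-symᵢ = proj₁ (matches⁻ C' Ci' x F' t')
    G' = transport (Ci ⊗ C') F'
    G'-symᵢ = transport-InSymDi (Ci ⊗ C') F'-symᵢ
    G'-matches : T (eqSubᵇ (Ω C Ci G') x)
    G'-matches = subst T (eqSubᵇ-congˡ x (Ω-transfer C' Ci' C Ci invC' invC Pi-but P-but F'-symᵢ))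
                         (proj₂ (matches⁻ C' Ci' x F' t'))

  states≈⇔triangular : ∀ C Ci C' Ci' S → IsInverse C Ci → IsInverse C' Ci' →
                       InSymDi i (congruence C S) → InSymDi i (congruence C' S) →
                       (state C Ci (congruence C S) ≈V state C' Ci' (congruence C' S))
                       ⇔ (BlockUpperTriangular (Ci ⊗ C') × BlockUpperTriangular (Ci' ⊗ C))
  states≈⇔triangular C Ci C' Ci' S invC invC' S₁-symᵢ S₂-symᵢ = mk⇔
    (λ states → states⇒triangular C Ci C' Ci' S₁ S₂ invC invC' states ,
                states⇒triangular C' Ci' C Ci S₂ S₁ invC' invC
                                  (≈V-sym {state C Ci S₁} {state C' Ci' S₂} states))
    (λ (P-but , Pi-but) → triangular⇒states C Ci C' Ci' S invC invC' P-but Pi-but S₁-symᵢ S₂-symᵢ)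
    where
    S₁ S₂ : Mat
    S₁ = congruence C S
    S₂ = congruence C' S

  ket-fixed⇔triangular : ∀ {P Pi} → IsInverse P Pi →
                         (ρ (elemC P Pi) (ket (xsub i)) ≈V ket (xsub i))
                         ⇔ (BlockUpperTriangular P × BlockUpperTriangular Pi)
  ket-fixed⇔triangular {P} {Pi} inv =
    ⇔.trans (ρ-ket-fixed⇔ 1<q (elemC P Pi) xsub-extensional) (elemC-stabilises-xsub inv)

lemma2 : (q : ℕ) .{{_ : NonZero q}} → Prime q → (D i : ℕ) → 1 ≤ D → i ≤ D →
    let open Field q D in
    (S C Ci C' Ci' : Mat) → IsSym S → IsInverse C Ci → IsInverse C' Ci' →
    InSymDi i ((C ᵀ) ⊗ (S ⊗ C)) → InSymDi i ((C' ᵀ) ⊗ (S ⊗ C')) →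
    (ρ (elemC C Ci) (stateI i ((C ᵀ) ⊗ (S ⊗ C)))
       ≈V ρ (elemC C' Ci') (stateI i ((C' ᵀ) ⊗ (S ⊗ C'))))
    ⇔ (ρ (elemC (Ci ⊗ C') (Ci' ⊗ C)) (ket (xsub i)) ≈V ket (xsub i))
-- Primality is only used through q > 1, and symmetry of S is subsumed by the hypotheses on CᵀSC, C'ᵀSC'.
lemma2 q p D i _ _ S C Ci C' Ci' _ invC invC' S₁-symᵢ S₂-symᵢ =
  ⇔.trans (states≈⇔triangular C Ci C' Ci' S invC invC' S₁-symᵢ S₂-symᵢ)
          (⇔.sym (ket-fixed⇔triangular (inverse-⊗ {Ci} {C} {C'} {Ci'} (inverse-sym {C} {Ci} invC) invC')))
  where
  open Matrices q D using (inverse-sym; inverse-⊗)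
  open Stabiliser q D i (ℕ.nonTrivial⇒n>1 q {{prime⇒nonTrivial p}})
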